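{- Let $\mathcal{J}(x,y)=\alpha x^2+\beta xy+\gamma y^2$ be an integral binary quadratic form with $\gcd(\alpha,\beta,\gamma)=1$ and $\beta^2-4\alpha\gamma\neq0$. For any $f,g\in W_{\mathcal{J}}(\mathbb{Z})$, if $(f,g)$ is a $\mathbb{Z}$-basis of $W_{\mathcal{J}}(\mathbb{Z})$, then $(f^2,fg,g^2)$ is a $\mathbb{Z}$-basis of $V_{\mathcal{J}}(\mathbb{Z})$.
   Context: For $T=\begin{pmatrix}t_1&t_2\\t_3&t_4\end{pmatrix}$, the twisted actions are $F_T(x,y)=\det(T)^{ -2}F(t_1x+t_2y,t_3x+t_4y)$ on binary quartic forms and $\varphi_T(x,y)=\det(T)^{ -1}\varphi(t_1x+t_2y,t_3x+t_4y)$ on binary quadratic forms. $M_{\mathcal{J}}=\begin{pmatrix}\beta&2\gamma\\-2\alpha&-\beta\end{pmatrix}$; $V_{\mathcal{J}}(\mathbb{Z})$ is the set of integral binary quartic forms $F$ with $F_{M_{\mathcal{J}}}=F$, and $W_{\mathcal{J}}(\mathbb{Z})$ is the set of integral binary quadratic forms $\varphi$ with $\varphi_{M_{\mathcal{J}}}=-\varphi$ (both free $\mathbb{Z}$-modules). -}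

module Defs where

open import Data.Integer using (ℤ; +_; _+_; _*_; -_; _-_)
open import Data.Integer.GCD using (gcd)
open import Data.Product using (_×_; ∃-syntax)
open import Relation.Binary.PropositionalEquality using (_≡_; _≢_)

-- Integral binary quadratic form  a x² + b xy + c y²
record Quad : Set where
  constructor quad
  field
    a b c : ℤ

-- Integral binary quartic form  a x⁴ + b x³y + c x²y² + d xy³ + e y⁴
record Quart : Set where
  constructor quart
  field
    a b c d e : ℤ

-- Linear form  p x + q y
record Lin : Set where
  constructor lin
  field
    p q : ℤ

_+Q_ : Quad → Quad → Quad
quad a b c +Q quad a' b' c' = quad (a + a') (b + b') (c + c')

_·Q_ : ℤ → Quad → Quad
k ·Q quad a b c = quad (k * a) (k * b) (k * c)

-Q_ : Quad → Quad
-Q quad a b c = quad (- a) (- b) (- c)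

0Q : Quad
0Q = quad (+ 0) (+ 0) (+ 0)

_+F_ : Quart → Quart → Quart
quart a b c d e +F quart a' b' c' d' e' =
  quart (a + a') (b + b') (c + c') (d + d') (e + e')

_·F_ : ℤ → Quart → Quart
k ·F quart a b c d e = quart (k * a) (k * b) (k * c) (k * d) (k * e)

0F : Quart
0F = quart (+ 0) (+ 0) (+ 0) (+ 0) (+ 0)

_*L_ : Lin → Lin → Quad
lin p q *L lin p' q' = quad (p * p') (p * q' + q * p') (q * q')

_*Q_ : Quad → Quad → Quart
quad a b c *Q quad a' b' c' =
  quart (a * a')
        (a * b' + b * a')
        (a * c' + b * b' + c * a')
        (b * c' + c * b')
        (c * c')

-- 2x2 integer matrices T = (t1 t2 ; t3 t4)
record Mat : Set where
  constructor mat
  field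
    t1 t2 t3 t4 : ℤ

det : Mat → ℤ
det (mat t1 t2 t3 t4) = t1 * t4 - t2 * t3

L₁ L₂ : Mat → Lin
L₁ (mat t1 t2 t3 t4) = lin t1 t2
L₂ (mat t1 t2 t3 t4) = lin t3 t4

-- φ(t1 x + t2 y, t3 x + t4 y)  (substitution, without the det factor)
substQ : Quad → Mat → Quad
substQ (quad a b c) T =
  ((a ·Q (u *L u)) +Q (b ·Q (u *L v))) +Q (c ·Q (v *L v))
  where
    u = L₁ T
    v = L₂ T

-- F(t1 x + t2 y, t3 x + t4 y)  (substitution, without the det factor)
substF : Quart → Mat → Quart
substF (quart a b c d e) T =
  ((((a ·F (uu *Q uu)) +F (b ·F (uu *Q uv))) +F (c ·F (uu *Q vv)))
     +F (d ·F (uv *Q vv))) +F (e ·F (vv *Q vv))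
  where
    uu = L₁ T *L L₁ T
    uv = L₁ T *L L₂ T
    vv = L₂ T *L L₂ T

M : Quad → Mat
M (quad α β γ) = mat β (+ 2 * γ) (- (+ 2 * α)) (- β)

-- F ∈ V_J(ℤ) :  F_{M_J} = F, where F_T = det(T)^{-2} F(T·).
-- Multiplied out by det(T)^2 (nonzero under the hypotheses):
InV : Quad → Quart → Set
InV J F = substF F (M J) ≡ (det (M J) * det (M J)) ·F F

-- φ ∈ W_J(ℤ) :  φ_{M_J} = -φ, where φ_T = det(T)^{-1} φ(T·).
-- Multiplied out by det(T) (nonzero under the hypotheses):
InW : Quad → Quad → Set
InW J φ = substQ φ (M J) ≡ det (M J) ·Q (-Q φ)

IsBasisW : Quad → Quad → Quad → Set
IsBasisW J f g =
  InW J f × InW J g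
  × (∀ φ → InW J φ → ∃[ m ] ∃[ n ] φ ≡ (m ·Q f) +Q (n ·Q g))
  × (∀ m n → (m ·Q f) +Q (n ·Q g) ≡ 0Q → m ≡ + 0 × n ≡ + 0)

IsBasisV : Quad → Quart → Quart → Quart → Set
IsBasisV J F G H =
  InV J F × InV J G × InV J H
  × (∀ K → InV J K → ∃[ l ] ∃[ m ] ∃[ n ] K ≡ ((l ·F F) +F (m ·F G)) +F (n ·F H))
  × (∀ l m n → ((l ·F F) +F (m ·F G)) +F (n ·F H) ≡ 0F
       → l ≡ + 0 × m ≡ + 0 × n ≡ + 0)

disc : Quad → ℤ
disc (quad α β γ) = β * β - + 4 * α * γ

gcd3 : Quad → ℤ
gcd3 (quad α β γ) = gcd α (gcd β γ)

-- Write φ ∙ ψ for the dot product of coefficient vectors and ℓ = (2γ, −β, 2α). Expanding, M_J acts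
-- on quadratic forms by φ ↦ −det(M_J)·φ + 2(ℓ ∙ φ)·J, so W_J is the kernel of ℓ ∙ _ (a saturated
-- lattice) and J is an eigenvector with eigenvalue det(M_J); products of two elements of W_J lie in
-- V_J. For K ∈ V_J, Cramer's rule with δ = [f, g, J] ≠ 0 writes δ²K as a combination of f², fg, g²,
-- J², Jf and Jg. Here J² is a sum of products of elements of W_J, while the Jf, Jg part is an
-- eigenvector for −det², so it vanishes. Finally one divides by δ² one prime p at a time: f and g
-- stay independent modulo p, and then p | lf² + mfg + ng² forces p | l, m, n, because F_p[x, y]
-- has no zero divisors. Iterating this with p = 2 also gives linear independence.

module Submission where

open import Defs
open import Data.Integer using (+_)
open import Relation.Binary.PropositionalEquality using (_≡_; _≢_)

open import Data.Empty using (⊥-elim)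
open import Data.Integer using (ℤ; 0ℤ; 1ℤ; +0; +[1+_]; -[1+_]; _+_; _*_; -_; _-_)
import Data.Integer as ℤ
import Data.Integer.Properties as ℤ
open import Data.Integer.Divisibility.Signed
  using (_∣_; divides; _∣?_; ∣-refl; ∣m∣n⇒∣m+n; ∣m⇒∣-m; ∣m+n∣m⇒∣n; ∣m+n∣n⇒∣m; ∣n⇒∣m*n; ∣m⇒∣m*n; ∣⇒∣ᵤ; ∣ᵤ⇒∣)
open import Data.Integer.Tactic.RingSolver using (solve-∀)
open import Data.List using ([]; _∷_)
open import Data.List.Relation.Unary.All using (All; []; _∷_)
open import Data.Nat as ℕ using (ℕ; zero; suc)
import Data.Nat.Properties as ℕ
import Data.Nat.Divisibility as ℕ
open import Data.Nat.ListAction using (product)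
open import Data.Nat.Primality using (Prime; euclidsLemma; prime[2]; ¬prime[0]; ¬prime[1])
open import Data.Nat.Primality.Factorisation using (factorise; PrimeFactorisation)
open import Data.Product using (_×_; _,_; proj₁; proj₂; ∃-syntax; swap)
import Data.Product as Product
open import Data.Sum using (_⊎_; inj₁; inj₂)
import Data.Sum as Sum
open import Function using (_∘_)
open import Function.Nary.NonDependent using (congₙ)
open import Relation.Binary.PropositionalEquality using (refl; sym; trans; cong; cong₂; subst; subst₂)
open import Relation.Nullary using (¬_; yes; no)
open Relation.Binary.PropositionalEquality.≡-Reasoning

infix 8 _∙_

_∙_ : Quad → Quad → ℤ
quad a b c ∙ quad a' b' c' = a * a' + b * b' + c * c'

_⨯_ : Quad → Quad → Quad
quad a b c ⨯ quad a' b' c' = quad (b * c' - c * b') (c * a' - a * c') (a * b' - b * a')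

[_,_,_] : Quad → Quad → Quad → ℤ
[ a , b , c ] = (a ⨯ b) ∙ c

∙-linearʳ : ∀ ℓ s t φ ψ → ℓ ∙ ((s ·Q φ) +Q (t ·Q ψ)) ≡ s * (ℓ ∙ φ) + t * (ℓ ∙ ψ)
∙-linearʳ (quad a₀ a₁ a₂) s t (quad b₀ b₁ b₂) (quad c₀ c₁ c₂) = expanded a₀ a₁ a₂ s t b₀ b₁ b₂ c₀ c₁ c₂
  where
    expanded : ∀ a₀ a₁ a₂ s t b₀ b₁ b₂ c₀ c₁ c₂ →
      a₀ * (s * b₀ + t * c₀) + a₁ * (s * b₁ + t * c₁) + a₂ * (s * b₂ + t * c₂)
        ≡ s * (a₀ * b₀ + a₁ * b₁ + a₂ * b₂) + t * (a₀ * c₀ + a₁ * c₁ + a₂ * c₂)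
    expanded = solve-∀

cramer : ∀ a b c φ →
  [ a , b , c ] ·Q φ ≡ (((φ ∙ b ⨯ c) ·Q a) +Q ((φ ∙ c ⨯ a) ·Q b)) +Q ((φ ∙ a ⨯ b) ·Q c)
cramer (quad a₀ a₁ a₂) (quad b₀ b₁ b₂) (quad c₀ c₁ c₂) (quad d₀ d₁ d₂) =
  congₙ 3 quad
    ([x²] a₀ a₁ a₂ b₀ b₁ b₂ c₀ c₁ c₂ d₀ d₁ d₂)
    ([xy] a₀ a₁ a₂ b₀ b₁ b₂ c₀ c₁ c₂ d₀ d₁ d₂)
    ([y²] a₀ a₁ a₂ b₀ b₁ b₂ c₀ c₁ c₂ d₀ d₁ d₂)
  where
    [x²] : ∀ a₀ a₁ a₂ b₀ b₁ b₂ c₀ c₁ c₂ d₀ d₁ d₂ →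
      ((a₁ * b₂ - a₂ * b₁) * c₀ + (a₂ * b₀ - a₀ * b₂) * c₁ + (a₀ * b₁ - a₁ * b₀) * c₂) * d₀
        ≡ (d₀ * (b₁ * c₂ - b₂ * c₁) + d₁ * (b₂ * c₀ - b₀ * c₂) + d₂ * (b₀ * c₁ - b₁ * c₀)) * a₀ + (d₀
          * (c₁ * a₂ - c₂ * a₁) + d₁ * (c₂ * a₀ - c₀ * a₂) + d₂ * (c₀ * a₁ - c₁ * a₀)) * b₀ + (d₀ * (a₁ * b₂ - a₂
          * b₁) + d₁ * (a₂ * b₀ - a₀ * b₂) + d₂ * (a₀ * b₁ - a₁ * b₀)) * c₀
    [x²] = solve-∀
    [xy] : ∀ a₀ a₁ a₂ b₀ b₁ b₂ c₀ c₁ c₂ d₀ d₁ d₂ →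
      ((a₁ * b₂ - a₂ * b₁) * c₀ + (a₂ * b₀ - a₀ * b₂) * c₁ + (a₀ * b₁ - a₁ * b₀) * c₂) * d₁
        ≡ (d₀ * (b₁ * c₂ - b₂ * c₁) + d₁ * (b₂ * c₀ - b₀ * c₂) + d₂ * (b₀ * c₁ - b₁ * c₀)) * a₁ + (d₀
          * (c₁ * a₂ - c₂ * a₁) + d₁ * (c₂ * a₀ - c₀ * a₂) + d₂ * (c₀ * a₁ - c₁ * a₀)) * b₁ + (d₀ * (a₁ * b₂ - a₂
          * b₁) + d₁ * (a₂ * b₀ - a₀ * b₂) + d₂ * (a₀ * b₁ - a₁ * b₀)) * c₁
    [xy] = solve-∀
    [y²] : ∀ a₀ a₁ a₂ b₀ b₁ b₂ c₀ c₁ c₂ d₀ d₁ d₂ →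
      ((a₁ * b₂ - a₂ * b₁) * c₀ + (a₂ * b₀ - a₀ * b₂) * c₁ + (a₀ * b₁ - a₁ * b₀) * c₂) * d₂
        ≡ (d₀ * (b₁ * c₂ - b₂ * c₁) + d₁ * (b₂ * c₀ - b₀ * c₂) + d₂ * (b₀ * c₁ - b₁ * c₀)) * a₂ + (d₀
          * (c₁ * a₂ - c₂ * a₁) + d₁ * (c₂ * a₀ - c₀ * a₂) + d₂ * (c₀ * a₁ - c₁ * a₀)) * b₂ + (d₀ * (a₁ * b₂ - a₂
          * b₁) + d₁ * (a₂ * b₀ - a₀ * b₂) + d₂ * (a₀ * b₁ - a₁ * b₀)) * c₂
    [y²] = solve-∀

⨯-expansion : ∀ ℓ a b c →
  (((ℓ ∙ a) ·Q (b ⨯ c)) +Q ((ℓ ∙ b) ·Q (c ⨯ a))) +Q ((ℓ ∙ c) ·Q (a ⨯ b)) ≡ [ a , b , c ] ·Q ℓ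
⨯-expansion (quad a₀ a₁ a₂) (quad b₀ b₁ b₂) (quad c₀ c₁ c₂) (quad d₀ d₁ d₂) =
  congₙ 3 quad
    ([x²] a₀ a₁ a₂ b₀ b₁ b₂ c₀ c₁ c₂ d₀ d₁ d₂)
    ([xy] a₀ a₁ a₂ b₀ b₁ b₂ c₀ c₁ c₂ d₀ d₁ d₂)
    ([y²] a₀ a₁ a₂ b₀ b₁ b₂ c₀ c₁ c₂ d₀ d₁ d₂)
  where
    [x²] : ∀ a₀ a₁ a₂ b₀ b₁ b₂ c₀ c₁ c₂ d₀ d₁ d₂ →
      (a₀ * b₀ + a₁ * b₁ + a₂ * b₂) * (c₁ * d₂ - c₂ * d₁) + (a₀ * c₀ + a₁ * c₁ + a₂ * c₂) * (d₁ * b₂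
        - d₂ * b₁) + (a₀ * d₀ + a₁ * d₁ + a₂ * d₂) * (b₁ * c₂ - b₂ * c₁)
        ≡ ((b₁ * c₂ - b₂ * c₁) * d₀ + (b₂ * c₀ - b₀ * c₂) * d₁ + (b₀ * c₁ - b₁ * c₀) * d₂) * a₀
    [x²] = solve-∀
    [xy] : ∀ a₀ a₁ a₂ b₀ b₁ b₂ c₀ c₁ c₂ d₀ d₁ d₂ →
      (a₀ * b₀ + a₁ * b₁ + a₂ * b₂) * (c₂ * d₀ - c₀ * d₂) + (a₀ * c₀ + a₁ * c₁ + a₂ * c₂) * (d₂ * b₀
        - d₀ * b₂) + (a₀ * d₀ + a₁ * d₁ + a₂ * d₂) * (b₂ * c₀ - b₀ * c₂)
        ≡ ((b₁ * c₂ - b₂ * c₁) * d₀ + (b₂ * c₀ - b₀ * c₂) * d₁ + (b₀ * c₁ - b₁ * c₀) * d₂) * a₁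
    [xy] = solve-∀
    [y²] : ∀ a₀ a₁ a₂ b₀ b₁ b₂ c₀ c₁ c₂ d₀ d₁ d₂ →
      (a₀ * b₀ + a₁ * b₁ + a₂ * b₂) * (c₀ * d₁ - c₁ * d₀) + (a₀ * c₀ + a₁ * c₁ + a₂ * c₂) * (d₀ * b₁
        - d₁ * b₀) + (a₀ * d₀ + a₁ * d₁ + a₂ * d₂) * (b₀ * c₁ - b₁ * c₀)
        ≡ ((b₁ * c₂ - b₂ * c₁) * d₀ + (b₂ * c₀ - b₀ * c₂) * d₁ + (b₀ * c₁ - b₁ * c₀) * d₂) * a₂
    [y²] = solve-∀

⨯-⨯ : ∀ e f g → e ⨯ (f ⨯ g) ≡ ((e ∙ g) ·Q f) +Q ((- (e ∙ f)) ·Q g)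
⨯-⨯ (quad a₀ a₁ a₂) (quad b₀ b₁ b₂) (quad c₀ c₁ c₂) =
  congₙ 3 quad
    ([x²] a₀ a₁ a₂ b₀ b₁ b₂ c₀ c₁ c₂)
    ([xy] a₀ a₁ a₂ b₀ b₁ b₂ c₀ c₁ c₂)
    ([y²] a₀ a₁ a₂ b₀ b₁ b₂ c₀ c₁ c₂)
  where
    [x²] : ∀ a₀ a₁ a₂ b₀ b₁ b₂ c₀ c₁ c₂ →
      a₁ * (b₀ * c₁ - b₁ * c₀) - a₂ * (b₂ * c₀ - b₀ * c₂)
        ≡ (a₀ * c₀ + a₁ * c₁ + a₂ * c₂) * b₀ + - (a₀ * b₀ + a₁ * b₁ + a₂ * b₂) * c₀
    [x²] = solve-∀
    [xy] : ∀ a₀ a₁ a₂ b₀ b₁ b₂ c₀ c₁ c₂ →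
      a₂ * (b₁ * c₂ - b₂ * c₁) - a₀ * (b₀ * c₁ - b₁ * c₀)
        ≡ (a₀ * c₀ + a₁ * c₁ + a₂ * c₂) * b₁ + - (a₀ * b₀ + a₁ * b₁ + a₂ * b₂) * c₁
    [xy] = solve-∀
    [y²] : ∀ a₀ a₁ a₂ b₀ b₁ b₂ c₀ c₁ c₂ →
      a₀ * (b₂ * c₀ - b₀ * c₂) - a₁ * (b₁ * c₂ - b₂ * c₁)
        ≡ (a₀ * c₀ + a₁ * c₁ + a₂ * c₂) * b₂ + - (a₀ * b₀ + a₁ * b₁ + a₂ * b₂) * c₂
    [y²] = solve-∀

⨯-zeroʳ : ∀ e → e ⨯ 0Q ≡ 0Q
⨯-zeroʳ (quad a₀ a₁ a₂) =
  congₙ 3 quad (coefficientwise a₁ a₂) (coefficientwise a₂ a₀) (coefficientwise a₀ a₁)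
  where
    coefficientwise : ∀ a₁ a₂ →
      a₁ * + 0 - a₂ * + 0
        ≡ + 0
    coefficientwise = solve-∀

x² xy y² : Quad
x² = quad (+ 1) (+ 0) (+ 0)
xy = quad (+ 0) (+ 1) (+ 0)
y² = quad (+ 0) (+ 0) (+ 1)

coordinates : ∀ f → f ≡ quad (x² ∙ f) (xy ∙ f) (y² ∙ f)
coordinates (quad a₀ a₁ a₂) =
  congₙ 3 quad ([x²] a₀ a₁ a₂) ([xy] a₀ a₁ a₂) ([y²] a₀ a₁ a₂)
  where
    [x²] : ∀ a₀ a₁ a₂ →
      a₀
        ≡ + 1 * a₀ + + 0 * a₁ + + 0 * a₂
    [x²] = solve-∀
    [xy] : ∀ a₀ a₁ a₂ →
      a₁
        ≡ + 0 * a₀ + + 1 * a₁ + + 0 * a₂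
    [xy] = solve-∀
    [y²] : ∀ a₀ a₁ a₂ →
      a₂
        ≡ + 0 * a₀ + + 0 * a₁ + + 1 * a₂
    [y²] = solve-∀

∙-nondegenerate : ∀ f → (∀ e → e ∙ f ≡ 0ℤ) → f ≡ 0Q
∙-nondegenerate f ∙f≡0 = trans (coordinates f) (congₙ 3 quad (∙f≡0 x²) (∙f≡0 xy) (∙f≡0 y²))

*-distinct⇒zero : ∀ {k k' x} → k ≢ k' → k * x ≡ k' * x → x ≡ 0ℤ
*-distinct⇒zero {k} {k'} {x} k≢k' kx≡k'x with x ℤ.≟ 0ℤ
... | yes x≡0 = x≡0
... | no  x≢0 = ⊥-elim (k≢k' (ℤ.*-cancelʳ-≡ k k' x {{ℤ.≢-nonZero x≢0}} kx≡k'x))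

i≢0⇒i≢-i : ∀ {i} → i ≢ 0ℤ → i ≢ - i
i≢0⇒i≢-i {+0}       i≢0 = ⊥-elim (i≢0 refl)
i≢0⇒i≢-i {+[1+ _ ]} _   ()
i≢0⇒i≢-i { -[1+ _ ]} _  ()

ℓ : Quad → Quad
ℓ (quad α β γ) = quad (+ 2 * γ) (- β) (+ 2 * α)

substQ-M : ∀ J φ → substQ φ (M J) ≡ (det (M J) ·Q (-Q φ)) +Q ((+ 2 * (ℓ J ∙ φ)) ·Q J)
substQ-M (quad α β γ) (quad φ₀ φ₁ φ₂) =
  congₙ 3 quad ([x²] α β γ φ₀ φ₁ φ₂) ([xy] α β γ φ₀ φ₁ φ₂) ([y²] α β γ φ₀ φ₁ φ₂)
  where
    [x²] : ∀ α β γ φ₀ φ₁ φ₂ →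
      φ₀ * (β * β) + φ₁ * (β * - (+ 2 * α)) + φ₂ * (- (+ 2 * α) * - (+ 2 * α))
        ≡ (β * - β - + 2 * γ * - (+ 2 * α)) * - φ₀ + + 2 * (+ 2 * γ * φ₀ + - β * φ₁ + + 2 * α
          * φ₂) * α
    [x²] = solve-∀
    [xy] : ∀ α β γ φ₀ φ₁ φ₂ →
      φ₀ * (β * (+ 2 * γ) + + 2 * γ * β) + φ₁ * (β * - β + + 2 * γ * - (+ 2 * α)) + φ₂ * (- (+ 2 * α)
        * - β + - β * - (+ 2 * α))
        ≡ (β * - β - + 2 * γ * - (+ 2 * α)) * - φ₁ + + 2 * (+ 2 * γ * φ₀ + - β * φ₁ + + 2 * α
          * φ₂) * β
    [xy] = solve-∀
    [y²] : ∀ α β γ φ₀ φ₁ φ₂ →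
      φ₀ * (+ 2 * γ * (+ 2 * γ)) + φ₁ * (+ 2 * γ * - β) + φ₂ * (- β * - β)
        ≡ (β * - β - + 2 * γ * - (+ 2 * α)) * - φ₂ + + 2 * (+ 2 * γ * φ₀ + - β * φ₁ + + 2 * α
          * φ₂) * γ
    [y²] = solve-∀

ℓ∙substQ-M : ∀ J φ → ℓ J ∙ substQ φ (M J) ≡ det (M J) * (ℓ J ∙ φ)
ℓ∙substQ-M (quad α β γ) (quad φ₀ φ₁ φ₂) = expanded α β γ φ₀ φ₁ φ₂
  where
    expanded : ∀ α β γ φ₀ φ₁ φ₂ →
      + 2 * γ * (φ₀ * (β * β) + φ₁ * (β * - (+ 2 * α)) + φ₂ * (- (+ 2 * α) * - (+ 2 * α))) +
        - β * (φ₀ * (β * (+ 2 * γ) + + 2 * γ * β) + φ₁ * (β * - β + + 2 * γ * - (+ 2 * α)) + φ₂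
        * (- (+ 2 * α) * - β + - β * - (+ 2 * α))) + + 2 * α * (φ₀ * (+ 2 * γ * (+ 2 * γ)) + φ₁
        * (+ 2 * γ * - β) + φ₂ * (- β * - β))
        ≡ (β * - β - + 2 * γ * - (+ 2 * α)) * (+ 2 * γ * φ₀ + - β * φ₁ + + 2 * α * φ₂)
    expanded = solve-∀

ℓ∙J≡det : ∀ J → ℓ J ∙ J ≡ det (M J)
ℓ∙J≡det (quad α β γ) = expanded α β γ
  where
    expanded : ∀ α β γ →
      + 2 * γ * α + - β * β + + 2 * α * γ
        ≡ β * - β - + 2 * γ * - (+ 2 * α)
    expanded = solve-∀

disc≡-det : ∀ J → disc J ≡ - det (M J)
disc≡-det (quad α β γ) = expanded α β γ
  where
    expanded : ∀ α β γ →
      β * β - + 4 * α * γ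
        ≡ - (β * - β - + 2 * γ * - (+ 2 * α))
    expanded = solve-∀

·Q-neg : ∀ k φ → k ·Q (-Q φ) ≡ (- k) ·Q φ
·Q-neg k (quad a₀ a₁ a₂) =
  congₙ 3 quad (coefficientwise k a₀) (coefficientwise k a₁) (coefficientwise k a₂)
  where
    coefficientwise : ∀ k a₀ →
      k * - a₀
        ≡ - k * a₀
    coefficientwise = solve-∀

∙-·Q-neg : ∀ ℓ k φ → ℓ ∙ (k ·Q (-Q φ)) ≡ (- k) * (ℓ ∙ φ)
∙-·Q-neg (quad a₀ a₁ a₂) k (quad b₀ b₁ b₂) = expanded a₀ a₁ a₂ k b₀ b₁ b₂
  where
    expanded : ∀ a₀ a₁ a₂ k b₀ b₁ b₂ →
      a₀ * (k * - b₀) + a₁ * (k * - b₁) + a₂ * (k * - b₂)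
        ≡ - k * (a₀ * b₀ + a₁ * b₁ + a₂ * b₂)
    expanded = solve-∀

+Q-0·Q : ∀ φ ψ → φ +Q (0ℤ ·Q ψ) ≡ φ
+Q-0·Q (quad a₀ a₁ a₂) (quad b₀ b₁ b₂) =
  congₙ 3 quad (coefficientwise a₀ b₀) (coefficientwise a₁ b₁) (coefficientwise a₂ b₂)
  where
    coefficientwise : ∀ a₀ b₀ →
      a₀ + + 0 * b₀
        ≡ a₀
    coefficientwise = solve-∀

InW⇒⟂ℓ : ∀ J φ → det (M J) ≢ 0ℤ → InW J φ → ℓ J ∙ φ ≡ 0ℤ
InW⇒⟂ℓ J φ d≢0 φ∈W = *-distinct⇒zero (i≢0⇒i≢-i d≢0) (begin
  det (M J) * (ℓ J ∙ φ)           ≡⟨ ℓ∙substQ-M J φ ⟨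
  ℓ J ∙ substQ φ (M J)            ≡⟨ cong (ℓ J ∙_) φ∈W ⟩
  ℓ J ∙ (det (M J) ·Q (-Q φ))     ≡⟨ ∙-·Q-neg (ℓ J) (det (M J)) φ ⟩
  (- det (M J)) * (ℓ J ∙ φ)       ∎)

⟂ℓ⇒InW : ∀ J φ → ℓ J ∙ φ ≡ 0ℤ → InW J φ
⟂ℓ⇒InW J φ ℓ∙φ≡0 = begin
  substQ φ (M J)                                              ≡⟨ substQ-M J φ ⟩
  (det (M J) ·Q (-Q φ)) +Q ((+ 2 * (ℓ J ∙ φ)) ·Q J)        ≡⟨ cong (λ x → (det (M J) ·Q (-Q φ)) +Q ((+ 2 * x) ·Q J)) ℓ∙φ≡0 ⟩
  (det (M J) ·Q (-Q φ)) +Q (0ℤ ·Q J)                          ≡⟨ +Q-0·Q _ J ⟩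
  det (M J) ·Q (-Q φ)                                         ∎

ℓ∙-lin≡0 : ∀ J s t {φ ψ} → det (M J) ≢ 0ℤ → InW J φ → InW J ψ → ℓ J ∙ ((s ·Q φ) +Q (t ·Q ψ)) ≡ 0ℤ
ℓ∙-lin≡0 J s t {φ} {ψ} d≢0 φ∈W ψ∈W = begin
  ℓ J ∙ ((s ·Q φ) +Q (t ·Q ψ))          ≡⟨ ∙-linearʳ (ℓ J) s t φ ψ ⟩
  s * (ℓ J ∙ φ) + t * (ℓ J ∙ ψ)          ≡⟨ cong₂ (λ x y → s * x + t * y) (InW⇒⟂ℓ J φ d≢0 φ∈W) (InW⇒⟂ℓ J ψ d≢0 ψ∈W) ⟩
  s * 0ℤ + t * 0ℤ                        ≡⟨ cong₂ _+_ (ℤ.*-zeroʳ s) (ℤ.*-zeroʳ t) ⟩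
  0ℤ                                     ∎

·Q-distinct⇒zero : ∀ {k k' φ} → k ≢ k' → k ·Q φ ≡ k' ·Q φ → φ ≡ 0Q
·Q-distinct⇒zero {φ = quad _ _ _} k≢k' eq =
  congₙ 3 quad (*-distinct⇒zero k≢k' (cong Quad.a eq)) (*-distinct⇒zero k≢k' (cong Quad.b eq))
               (*-distinct⇒zero k≢k' (cong Quad.c eq))

·F-distinct⇒zero : ∀ {k k' F} → k ≢ k' → k ·F F ≡ k' ·F F → F ≡ 0F
·F-distinct⇒zero {F = quart _ _ _ _ _} k≢k' eq =
  congₙ 5 quart (*-distinct⇒zero k≢k' (cong Quart.a eq)) (*-distinct⇒zero k≢k' (cong Quart.b eq))
                (*-distinct⇒zero k≢k' (cong Quart.c eq)) (*-distinct⇒zero k≢k' (cong Quart.d eq))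
                (*-distinct⇒zero k≢k' (cong Quart.e eq))

Independent : Quad → Quad → Set
Independent f g = ∀ m n → (m ·Q f) +Q (n ·Q g) ≡ 0Q → m ≡ + 0 × n ≡ + 0

1·φ+0·ψ≡φ : ∀ φ ψ → ((+ 1) ·Q φ) +Q ((+ 0) ·Q ψ) ≡ φ
1·φ+0·ψ≡φ (quad a₀ a₁ a₂) (quad b₀ b₁ b₂) =
  congₙ 3 quad (coefficientwise a₀ b₀) (coefficientwise a₁ b₁) (coefficientwise a₂ b₂)
  where
    coefficientwise : ∀ a₀ b₀ →
      + 1 * a₀ + + 0 * b₀
        ≡ a₀
    coefficientwise = solve-∀

-i≡0⇒i≡0 : ∀ {i} → - i ≡ 0ℤ → i ≡ 0ℤ
-i≡0⇒i≡0 {i} -i≡0 = trans (sym (ℤ.neg-involutive i)) (cong -_ -i≡0)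

independent⇒∙≡0 : ∀ {f g} → Independent f g → f ⨯ g ≡ 0Q → ∀ e → e ∙ f ≡ 0ℤ
independent⇒∙≡0 {f} {g} ind f⨯g≡0 e = -i≡0⇒i≡0 (proj₂ (ind (e ∙ g) (- (e ∙ f)) e⨯[f⨯g]≡0))
  where
    e⨯[f⨯g]≡0 : ((e ∙ g) ·Q f) +Q ((- (e ∙ f)) ·Q g) ≡ 0Q
    e⨯[f⨯g]≡0 = trans (sym (⨯-⨯ e f g)) (trans (cong (e ⨯_) f⨯g≡0) (⨯-zeroʳ e))

independent⇒⨯≢0 : ∀ {f g} → Independent f g → f ⨯ g ≢ 0Q
independent⇒⨯≢0 {f} {g} ind f⨯g≡0 = 1≢0 (proj₁ (ind (+ 1) (+ 0) 1·f+0·g≡0))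
  where
    1≢0 : + 1 ≢ + 0
    1≢0 ()
    1·f+0·g≡0 : ((+ 1) ·Q f) +Q ((+ 0) ·Q g) ≡ 0Q
    1·f+0·g≡0 = trans (1·φ+0·ψ≡φ f g) (∙-nondegenerate f (independent⇒∙≡0 ind f⨯g≡0))

det≢0 : ∀ J → disc J ≢ + 0 → det (M J) ≢ 0ℤ
det≢0 J disc≢0 d≡0 = disc≢0 (trans (disc≡-det J) (cong -_ d≡0))

0·a+0·b+k·c≡k·c : ∀ a b k c → ((0ℤ ·Q a) +Q (0ℤ ·Q b)) +Q (k ·Q c) ≡ k ·Q c
0·a+0·b+k·c≡k·c (quad a₀ a₁ a₂) (quad b₀ b₁ b₂) k (quad c₀ c₁ c₂) =
  congₙ 3 quad (coefficientwise a₀ b₀ k c₀) (coefficientwise a₁ b₁ k c₁) (coefficientwise a₂ b₂ k c₂)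
  where
    coefficientwise : ∀ a₀ b₀ k c₀ →
      + 0 * a₀ + + 0 * b₀ + k * c₀
        ≡ k * c₀
    coefficientwise = solve-∀

[f,g,J]≢0 : ∀ J {f g} → det (M J) ≢ 0ℤ → InW J f → InW J g → Independent f g → [ f , g , J ] ≢ 0ℤ
[f,g,J]≢0 J {f} {g} d≢0 f∈W g∈W ind [f,g,J]≡0 = independent⇒⨯≢0 ind (·Q-distinct⇒zero d≢0 (begin
  det (M J) ·Q (f ⨯ g)                                             ≡⟨ 0·a+0·b+k·c≡k·c (g ⨯ J) (J ⨯ f) (det (M J)) (f ⨯ g) ⟨
  ((0ℤ ·Q (g ⨯ J)) +Q (0ℤ ·Q (J ⨯ f))) +Q (det (M J) ·Q (f ⨯ g))   ≡⟨ congₙ 3 (λ x y z → ((x ·Q (g ⨯ J)) +Q (y ·Q (J ⨯ f))) +Q (z ·Q (f ⨯ g)))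
                                                                        (sym (InW⇒⟂ℓ J f d≢0 f∈W)) (sym (InW⇒⟂ℓ J g d≢0 g∈W)) (sym (ℓ∙J≡det J)) ⟩
  (((ℓ J ∙ f) ·Q (g ⨯ J)) +Q ((ℓ J ∙ g) ·Q (J ⨯ f))) +Q ((ℓ J ∙ J) ·Q (f ⨯ g)) ≡⟨ ⨯-expansion (ℓ J) f g J ⟩
  [ f , g , J ] ·Q ℓ J                                             ≡⟨ cong (_·Q ℓ J) [f,g,J]≡0 ⟩
  0ℤ ·Q ℓ J                                                        ≡⟨⟩
  0ℤ ·Q (f ⨯ g)                                                    ∎))

lin₅ : Quart → Quart → Quart → Quart → Quart → Quart → Quart
lin₅ (quart a b c d e) P₀ P₁ P₂ P₃ P₄ = ((((a ·F P₀) +F (b ·F P₁)) +F (c ·F P₂)) +F (d ·F P₃)) +F (e ·F P₄)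

lin₅-+ : ∀ F G P₀ P₁ P₂ P₃ P₄ → lin₅ (F +F G) P₀ P₁ P₂ P₃ P₄ ≡ lin₅ F P₀ P₁ P₂ P₃ P₄ +F lin₅ G P₀ P₁ P₂ P₃ P₄
lin₅-+ (quart F₀ F₁ F₂ F₃ F₄) (quart G₀ G₁ G₂ G₃ G₄)
       (quart H₀ H₁ H₂ H₃ H₄) (quart K₀ K₁ K₂ K₃ K₄) (quart L₀ L₁ L₂ L₃ L₄) (quart N₀ N₁ N₂ N₃ N₄) (quart O₀ O₁ O₂ O₃ O₄) =
  congₙ 5 quart
    (coefficientwise F₀ F₁ F₂ F₃ F₄ G₀ G₁ G₂ G₃ G₄ H₀ K₀ L₀ N₀ O₀)
    (coefficientwise F₀ F₁ F₂ F₃ F₄ G₀ G₁ G₂ G₃ G₄ H₁ K₁ L₁ N₁ O₁)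
    (coefficientwise F₀ F₁ F₂ F₃ F₄ G₀ G₁ G₂ G₃ G₄ H₂ K₂ L₂ N₂ O₂)
    (coefficientwise F₀ F₁ F₂ F₃ F₄ G₀ G₁ G₂ G₃ G₄ H₃ K₃ L₃ N₃ O₃)
    (coefficientwise F₀ F₁ F₂ F₃ F₄ G₀ G₁ G₂ G₃ G₄ H₄ K₄ L₄ N₄ O₄)
  where
    coefficientwise : ∀ F₀ F₁ F₂ F₃ F₄ G₀ G₁ G₂ G₃ G₄ H₀ K₀ L₀ N₀ O₀ →
      (F₀ + G₀) * H₀ + (F₁ + G₁) * K₀ + (F₂ + G₂) * L₀ + (F₃ + G₃) * N₀ + (F₄ + G₄) * O₀
        ≡ F₀ * H₀ + F₁ * K₀ + F₂ * L₀ + F₃ * N₀ + F₄ * O₀ + (G₀ * H₀ + G₁ * K₀ + G₂ * L₀ + G₃ * N₀ + G₄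
          * O₀)
    coefficientwise = solve-∀

lin₅-· : ∀ k F P₀ P₁ P₂ P₃ P₄ → lin₅ (k ·F F) P₀ P₁ P₂ P₃ P₄ ≡ k ·F lin₅ F P₀ P₁ P₂ P₃ P₄
lin₅-· k (quart F₀ F₁ F₂ F₃ F₄)
       (quart H₀ H₁ H₂ H₃ H₄) (quart K₀ K₁ K₂ K₃ K₄) (quart L₀ L₁ L₂ L₃ L₄) (quart N₀ N₁ N₂ N₃ N₄) (quart O₀ O₁ O₂ O₃ O₄) =
  congₙ 5 quart
    (coefficientwise k F₀ F₁ F₂ F₃ F₄ H₀ K₀ L₀ N₀ O₀)
    (coefficientwise k F₀ F₁ F₂ F₃ F₄ H₁ K₁ L₁ N₁ O₁)
    (coefficientwise k F₀ F₁ F₂ F₃ F₄ H₂ K₂ L₂ N₂ O₂)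
    (coefficientwise k F₀ F₁ F₂ F₃ F₄ H₃ K₃ L₃ N₃ O₃)
    (coefficientwise k F₀ F₁ F₂ F₃ F₄ H₄ K₄ L₄ N₄ O₄)
  where
    coefficientwise : ∀ k F₀ F₁ F₂ F₃ F₄ H₀ K₀ L₀ N₀ O₀ →
      k * F₀ * H₀ + k * F₁ * K₀ + k * F₂ * L₀ + k * F₃ * N₀ + k * F₄ * O₀
        ≡ k * (F₀ * H₀ + F₁ * K₀ + F₂ * L₀ + F₃ * N₀ + F₄ * O₀)
    coefficientwise = solve-∀

module _ (T : Mat) where

  private
    uu = L₁ T *L L₁ T
    uv = L₁ T *L L₂ T
    vv = L₂ T *L L₂ T

  substF-+ : ∀ F G → substF (F +F G) T ≡ substF F T +F substF G T
  substF-+ F G = lin₅-+ F G (uu *Q uu) (uu *Q uv) (uu *Q vv) (uv *Q vv) (vv *Q vv)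

  substF-· : ∀ k F → substF (k ·F F) T ≡ k ·F substF F T
  substF-· k F = lin₅-· k F (uu *Q uu) (uu *Q uv) (uu *Q vv) (uv *Q vv) (vv *Q vv)

substF-*Q : ∀ T φ ψ → substF (φ *Q ψ) T ≡ substQ φ T *Q substQ ψ T
substF-*Q (mat t₁ t₂ t₃ t₄) (quad a₀ a₁ a₂) (quad b₀ b₁ b₂) =
  congₙ 5 quart
    ([x⁴,y⁴] t₁ t₃ a₀ a₁ a₂ b₀ b₁ b₂)
    ([x³y] t₁ t₂ t₃ t₄ a₀ a₁ a₂ b₀ b₁ b₂)
    ([x²y²] t₁ t₂ t₃ t₄ a₀ a₁ a₂ b₀ b₁ b₂)
    ([xy³] t₁ t₂ t₃ t₄ a₀ a₁ a₂ b₀ b₁ b₂)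
    ([x⁴,y⁴] t₂ t₄ a₀ a₁ a₂ b₀ b₁ b₂)
  where
    [x⁴,y⁴] : ∀ t₁ t₃ a₀ a₁ a₂ b₀ b₁ b₂ →
      a₀ * b₀ * (t₁ * t₁ * (t₁ * t₁)) + (a₀ * b₁ + a₁ * b₀) * (t₁ * t₁ * (t₁ * t₃)) + (a₀ * b₂ + a₁
        * b₁ + a₂ * b₀) * (t₁ * t₁ * (t₃ * t₃)) + (a₁ * b₂ + a₂ * b₁) * (t₁ * t₃ * (t₃ * t₃)) + a₂ * b₂
        * (t₃ * t₃ * (t₃ * t₃))
        ≡ (a₀ * (t₁ * t₁) + a₁ * (t₁ * t₃) + a₂ * (t₃ * t₃)) * (b₀ * (t₁ * t₁) + b₁ * (t₁ * t₃) + b₂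
          * (t₃ * t₃))
    [x⁴,y⁴] = solve-∀
    [x³y] : ∀ t₁ t₂ t₃ t₄ a₀ a₁ a₂ b₀ b₁ b₂ →
      a₀ * b₀ * (t₁ * t₁ * (t₁ * t₂ + t₂ * t₁) + (t₁ * t₂ + t₂ * t₁) * (t₁ * t₁)) + (a₀ * b₁ + a₁ * b₀)
        * (t₁ * t₁ * (t₁ * t₄ + t₂ * t₃) + (t₁ * t₂ + t₂ * t₁) * (t₁ * t₃)) + (a₀ * b₂ + a₁ * b₁ + a₂
        * b₀) * (t₁ * t₁ * (t₃ * t₄ + t₄ * t₃) + (t₁ * t₂ + t₂ * t₁) * (t₃ * t₃)) + (a₁ * b₂ + a₂ * b₁)
        * (t₁ * t₃ * (t₃ * t₄ + t₄ * t₃) + (t₁ * t₄ + t₂ * t₃) * (t₃ * t₃)) + a₂ * b₂ * (t₃ * t₃ * (t₃ * t₄ + t₄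
        * t₃) + (t₃ * t₄ + t₄ * t₃) * (t₃ * t₃))
        ≡ (a₀ * (t₁ * t₁) + a₁ * (t₁ * t₃) + a₂ * (t₃ * t₃)) * (b₀ * (t₁ * t₂ + t₂ * t₁) + b₁ * (t₁ * t₄ + t₂
          * t₃) + b₂ * (t₃ * t₄ + t₄ * t₃)) + (a₀ * (t₁ * t₂ + t₂ * t₁) + a₁ * (t₁ * t₄ + t₂ * t₃) + a₂
          * (t₃ * t₄ + t₄ * t₃)) * (b₀ * (t₁ * t₁) + b₁ * (t₁ * t₃) + b₂ * (t₃ * t₃))
    [x³y] = solve-∀
    [x²y²] : ∀ t₁ t₂ t₃ t₄ a₀ a₁ a₂ b₀ b₁ b₂ →
      a₀ * b₀ * (t₁ * t₁ * (t₂ * t₂) + (t₁ * t₂ + t₂ * t₁) * (t₁ * t₂ + t₂ * t₁) + t₂ * t₂ * (t₁ * t₁))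
        + (a₀ * b₁ + a₁ * b₀) * (t₁ * t₁ * (t₂ * t₄) + (t₁ * t₂ + t₂ * t₁) * (t₁ * t₄ + t₂ * t₃) + t₂
        * t₂ * (t₁ * t₃)) + (a₀ * b₂ + a₁ * b₁ + a₂ * b₀) * (t₁ * t₁ * (t₄ * t₄) + (t₁ * t₂ + t₂ * t₁)
        * (t₃ * t₄ + t₄ * t₃) + t₂ * t₂ * (t₃ * t₃)) + (a₁ * b₂ + a₂ * b₁) * (t₁ * t₃ * (t₄ * t₄) + (t₁ * t₄ + t₂
        * t₃) * (t₃ * t₄ + t₄ * t₃) + t₂ * t₄ * (t₃ * t₃)) + a₂ * b₂ * (t₃ * t₃ * (t₄ * t₄) + (t₃ * t₄ + t₄ * t₃)
        * (t₃ * t₄ + t₄ * t₃) + t₄ * t₄ * (t₃ * t₃))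
        ≡ (a₀ * (t₁ * t₁) + a₁ * (t₁ * t₃) + a₂ * (t₃ * t₃)) * (b₀ * (t₂ * t₂) + b₁ * (t₂ * t₄) + b₂
          * (t₄ * t₄)) + (a₀ * (t₁ * t₂ + t₂ * t₁) + a₁ * (t₁ * t₄ + t₂ * t₃) + a₂ * (t₃ * t₄ + t₄ * t₃))
          * (b₀ * (t₁ * t₂ + t₂ * t₁) + b₁ * (t₁ * t₄ + t₂ * t₃) + b₂ * (t₃ * t₄ + t₄ * t₃)) + (a₀ * (t₂ * t₂)
          + a₁ * (t₂ * t₄) + a₂ * (t₄ * t₄)) * (b₀ * (t₁ * t₁) + b₁ * (t₁ * t₃) + b₂ * (t₃ * t₃))
    [x²y²] = solve-∀
    [xy³] : ∀ t₁ t₂ t₃ t₄ a₀ a₁ a₂ b₀ b₁ b₂ →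
      a₀ * b₀ * ((t₁ * t₂ + t₂ * t₁) * (t₂ * t₂) + t₂ * t₂ * (t₁ * t₂ + t₂ * t₁)) + (a₀ * b₁ + a₁ * b₀)
        * ((t₁ * t₂ + t₂ * t₁) * (t₂ * t₄) + t₂ * t₂ * (t₁ * t₄ + t₂ * t₃)) + (a₀ * b₂ + a₁ * b₁ + a₂
        * b₀) * ((t₁ * t₂ + t₂ * t₁) * (t₄ * t₄) + t₂ * t₂ * (t₃ * t₄ + t₄ * t₃)) + (a₁ * b₂ + a₂ * b₁)
        * ((t₁ * t₄ + t₂ * t₃) * (t₄ * t₄) + t₂ * t₄ * (t₃ * t₄ + t₄ * t₃)) + a₂ * b₂ * ((t₃ * t₄ + t₄ * t₃)
        * (t₄ * t₄) + t₄ * t₄ * (t₃ * t₄ + t₄ * t₃))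
        ≡ (a₀ * (t₁ * t₂ + t₂ * t₁) + a₁ * (t₁ * t₄ + t₂ * t₃) + a₂ * (t₃ * t₄ + t₄ * t₃)) * (b₀ * (t₂ * t₂)
          + b₁ * (t₂ * t₄) + b₂ * (t₄ * t₄)) + (a₀ * (t₂ * t₂) + a₁ * (t₂ * t₄) + a₂ * (t₄ * t₄)) * (b₀
          * (t₁ * t₂ + t₂ * t₁) + b₁ * (t₁ * t₄ + t₂ * t₃) + b₂ * (t₃ * t₄ + t₄ * t₃))
    [xy³] = solve-∀

·F-distrib-+F : ∀ k F G → k ·F (F +F G) ≡ (k ·F F) +F (k ·F G)
·F-distrib-+F k (quart F₀ F₁ F₂ F₃ F₄) (quart G₀ G₁ G₂ G₃ G₄) =
  congₙ 5 quart
    (coefficientwise k F₀ G₀)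
    (coefficientwise k F₁ G₁)
    (coefficientwise k F₂ G₂)
    (coefficientwise k F₃ G₃)
    (coefficientwise k F₄ G₄)
  where
    coefficientwise : ∀ k F₀ G₀ →
      k * (F₀ + G₀)
        ≡ k * F₀ + k * G₀
    coefficientwise = solve-∀

·F-comm : ∀ k k' F → k ·F (k' ·F F) ≡ k' ·F (k ·F F)
·F-comm k k' (quart F₀ F₁ F₂ F₃ F₄) =
  congₙ 5 quart
    (coefficientwise k k' F₀)
    (coefficientwise k k' F₁)
    (coefficientwise k k' F₂)
    (coefficientwise k k' F₃)
    (coefficientwise k k' F₄)
  where
    coefficientwise : ∀ k k' F₀ →
      k * (k' * F₀)
        ≡ k' * (k * F₀)
    coefficientwise = solve-∀

·Q-*Q-·Q : ∀ k k' φ ψ → (k ·Q φ) *Q (k' ·Q ψ) ≡ (k * k') ·F (φ *Q ψ)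
·Q-*Q-·Q k k' (quad a₀ a₁ a₂) (quad b₀ b₁ b₂) =
  congₙ 5 quart
    ([x⁴,y⁴] k k' a₀ b₀)
    ([x³y,xy³] k k' a₀ a₁ b₀ b₁)
    ([x²y²] k k' a₀ a₁ a₂ b₀ b₁ b₂)
    ([x³y,xy³] k k' a₁ a₂ b₁ b₂)
    ([x⁴,y⁴] k k' a₂ b₂)
  where
    [x⁴,y⁴] : ∀ k k' a₀ b₀ →
      k * a₀ * (k' * b₀)
        ≡ k * k' * (a₀ * b₀)
    [x⁴,y⁴] = solve-∀
    [x³y,xy³] : ∀ k k' a₀ a₁ b₀ b₁ →
      k * a₀ * (k' * b₁) + k * a₁ * (k' * b₀)
        ≡ k * k' * (a₀ * b₁ + a₁ * b₀)
    [x³y,xy³] = solve-∀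
    [x²y²] : ∀ k k' a₀ a₁ a₂ b₀ b₁ b₂ →
      k * a₀ * (k' * b₂) + k * a₁ * (k' * b₁) + k * a₂ * (k' * b₀)
        ≡ k * k' * (a₀ * b₂ + a₁ * b₁ + a₂ * b₀)
    [x²y²] = solve-∀

+F-difference : ∀ F G → G ≡ (F +F G) +F ((- 1ℤ) ·F F)
+F-difference (quart F₀ F₁ F₂ F₃ F₄) (quart G₀ G₁ G₂ G₃ G₄) =
  congₙ 5 quart
    (coefficientwise F₀ G₀)
    (coefficientwise F₁ G₁)
    (coefficientwise F₂ G₂)
    (coefficientwise F₃ G₃)
    (coefficientwise F₄ G₄)
  where
    coefficientwise : ∀ F₀ G₀ →
      G₀
        ≡ F₀ + G₀ + - (+ 1) * F₀
    coefficientwise = solve-∀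

EigenF : Mat → ℤ → Quart → Set
EigenF T k F = substF F T ≡ k ·F F

module _ {T : Mat} {k : ℤ} where

  EigenF-+ : ∀ {F G} → EigenF T k F → EigenF T k G → EigenF T k (F +F G)
  EigenF-+ {F} {G} eF eG = begin
    substF (F +F G) T           ≡⟨ substF-+ T F G ⟩
    substF F T +F substF G T    ≡⟨ cong₂ _+F_ eF eG ⟩
    (k ·F F) +F (k ·F G)        ≡⟨ ·F-distrib-+F k F G ⟨
    k ·F (F +F G)               ∎

  EigenF-· : ∀ k' {F} → EigenF T k F → EigenF T k (k' ·F F)
  EigenF-· k' {F} eF = begin
    substF (k' ·F F) T    ≡⟨ substF-· T k' F ⟩
    k' ·F substF F T      ≡⟨ cong (k' ·F_) eF ⟩
    k' ·F (k ·F F)        ≡⟨ ·F-comm k' k F ⟩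
    k ·F (k' ·F F)        ∎

  EigenF-cancelˡ : ∀ {F G} → EigenF T k F → EigenF T k (F +F G) → EigenF T k G
  EigenF-cancelˡ {F} {G} eF eFG =
    subst (EigenF T k) (sym (+F-difference F G)) (EigenF-+ eFG (EigenF-· (- 1ℤ) eF))

EigenF-*Q : ∀ {T k k' φ ψ} → substQ φ T ≡ k ·Q φ → substQ ψ T ≡ k' ·Q ψ → EigenF T (k * k') (φ *Q ψ)
EigenF-*Q {T} {k} {k'} {φ} {ψ} eφ eψ = begin
  substF (φ *Q ψ) T            ≡⟨ substF-*Q T φ ψ ⟩
  substQ φ T *Q substQ ψ T     ≡⟨ cong₂ _*Q_ eφ eψ ⟩
  (k ·Q φ) *Q (k' ·Q ψ)        ≡⟨ ·Q-*Q-·Q k k' φ ψ ⟩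
  (k * k') ·F (φ *Q ψ)         ∎

EigenF-unique : ∀ {T k k' F} → k ≢ k' → EigenF T k F → EigenF T k' F → F ≡ 0F
EigenF-unique k≢k' eF eF' = ·F-distinct⇒zero k≢k' (trans (sym eF) eF')

lin₃ : ℤ → ℤ → ℤ → Quart → Quart → Quart → Quart
lin₃ l m n A B C = ((l ·F A) +F (m ·F B)) +F (n ·F C)

lin₃-+ : ∀ l m n l' m' n' A B C → lin₃ l m n A B C +F lin₃ l' m' n' A B C ≡ lin₃ (l + l') (m + m') (n + n') A B C
lin₃-+ l m n l' m' n' (quart F₀ F₁ F₂ F₃ F₄) (quart G₀ G₁ G₂ G₃ G₄) (quart H₀ H₁ H₂ H₃ H₄) =
  congₙ 5 quart
    (coefficientwise l m n l' m' n' F₀ G₀ H₀)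
    (coefficientwise l m n l' m' n' F₁ G₁ H₁)
    (coefficientwise l m n l' m' n' F₂ G₂ H₂)
    (coefficientwise l m n l' m' n' F₃ G₃ H₃)
    (coefficientwise l m n l' m' n' F₄ G₄ H₄)
  where
    coefficientwise : ∀ l m n l' m' n' F₀ G₀ H₀ →
      l * F₀ + m * G₀ + n * H₀ + (l' * F₀ + m' * G₀ + n' * H₀)
        ≡ (l + l') * F₀ + (m + m') * G₀ + (n + n') * H₀
    coefficientwise = solve-∀

lin₃-· : ∀ k l m n A B C → k ·F lin₃ l m n A B C ≡ lin₃ (k * l) (k * m) (k * n) A B C
lin₃-· k l m n (quart F₀ F₁ F₂ F₃ F₄) (quart G₀ G₁ G₂ G₃ G₄) (quart H₀ H₁ H₂ H₃ H₄) =
  congₙ 5 quart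
    (coefficientwise k l m n F₀ G₀ H₀)
    (coefficientwise k l m n F₁ G₁ H₁)
    (coefficientwise k l m n F₂ G₂ H₂)
    (coefficientwise k l m n F₃ G₃ H₃)
    (coefficientwise k l m n F₄ G₄ H₄)
  where
    coefficientwise : ∀ k l m n F₀ G₀ H₀ →
      k * (l * F₀ + m * G₀ + n * H₀)
        ≡ k * l * F₀ + k * m * G₀ + k * n * H₀
    coefficientwise = solve-∀

lin₃-·ʳ : ∀ l m n k A B C → lin₃ (l * k) (m * k) (n * k) A B C ≡ k ·F lin₃ l m n A B C
lin₃-·ʳ l m n k (quart F₀ F₁ F₂ F₃ F₄) (quart G₀ G₁ G₂ G₃ G₄) (quart H₀ H₁ H₂ H₃ H₄) =
  congₙ 5 quart
    (coefficientwise l m n k F₀ G₀ H₀)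
    (coefficientwise l m n k F₁ G₁ H₁)
    (coefficientwise l m n k F₂ G₂ H₂)
    (coefficientwise l m n k F₃ G₃ H₃)
    (coefficientwise l m n k F₄ G₄ H₄)
  where
    coefficientwise : ∀ l m n k F₀ G₀ H₀ →
      l * k * F₀ + m * k * G₀ + n * k * H₀
        ≡ k * (l * F₀ + m * G₀ + n * H₀)
    coefficientwise = solve-∀

comb₂ : Quad → Quad → ℤ → ℤ → ℤ → Quart
comb₂ f g l m n = lin₃ l m n (f *Q f) (f *Q g) (g *Q g)

comb₂-+ : ∀ f g l m n l' m' n' → comb₂ f g l m n +F comb₂ f g l' m' n' ≡ comb₂ f g (l + l') (m + m') (n + n')
comb₂-+ f g l m n l' m' n' = lin₃-+ l m n l' m' n' (f *Q f) (f *Q g) (g *Q g)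

span₂-*Q : ∀ f g m n m' n' →
  ((m ·Q f) +Q (n ·Q g)) *Q ((m' ·Q f) +Q (n' ·Q g)) ≡ comb₂ f g (m * m') (m * n' + n * m') (n * n')
span₂-*Q (quad a₀ a₁ a₂) (quad b₀ b₁ b₂) m n m' n' =
  congₙ 5 quart
    ([x⁴,y⁴] a₀ b₀ m n m' n')
    ([x³y,xy³] a₀ a₁ b₀ b₁ m n m' n')
    ([x²y²] a₀ a₁ a₂ b₀ b₁ b₂ m n m' n')
    ([x³y,xy³] a₁ a₂ b₁ b₂ m n m' n')
    ([x⁴,y⁴] a₂ b₂ m n m' n')
  where
    [x⁴,y⁴] : ∀ a₀ b₀ m n m' n' →
      (m * a₀ + n * b₀) * (m' * a₀ + n' * b₀)
        ≡ m * m' * (a₀ * a₀) + (m * n' + n * m') * (a₀ * b₀) + n * n' * (b₀ * b₀)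
    [x⁴,y⁴] = solve-∀
    [x³y,xy³] : ∀ a₀ a₁ b₀ b₁ m n m' n' →
      (m * a₀ + n * b₀) * (m' * a₁ + n' * b₁) + (m * a₁ + n * b₁) * (m' * a₀ + n' * b₀)
        ≡ m * m' * (a₀ * a₁ + a₁ * a₀) + (m * n' + n * m') * (a₀ * b₁ + a₁ * b₀) + n * n' * (b₀ * b₁
          + b₁ * b₀)
    [x³y,xy³] = solve-∀
    [x²y²] : ∀ a₀ a₁ a₂ b₀ b₁ b₂ m n m' n' →
      (m * a₀ + n * b₀) * (m' * a₂ + n' * b₂) + (m * a₁ + n * b₁) * (m' * a₁ + n' * b₁) + (m * a₂ + n
        * b₂) * (m' * a₀ + n' * b₀)
        ≡ m * m' * (a₀ * a₂ + a₁ * a₁ + a₂ * a₀) + (m * n' + n * m') * (a₀ * b₂ + a₁ * b₁ + a₂ * b₀)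
          + n * n' * (b₀ * b₂ + b₁ * b₁ + b₂ * b₀)
    [x²y²] = solve-∀

J-eigen : ∀ J → substQ J (M J) ≡ det (M J) ·Q J
J-eigen (quad α β γ) =
  congₙ 3 quad ([x²] α β γ) ([xy] α β γ) ([y²] α β γ)
  where
    [x²] : ∀ α β γ →
      α * (β * β) + β * (β * - (+ 2 * α)) + γ * (- (+ 2 * α) * - (+ 2 * α))
        ≡ (β * - β - + 2 * γ * - (+ 2 * α)) * α
    [x²] = solve-∀
    [xy] : ∀ α β γ →
      α * (β * (+ 2 * γ) + + 2 * γ * β) + β * (β * - β + + 2 * γ * - (+ 2 * α)) + γ * (- (+ 2 * α)
        * - β + - β * - (+ 2 * α))
        ≡ (β * - β - + 2 * γ * - (+ 2 * α)) * β
    [xy] = solve-∀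
    [y²] : ∀ α β γ →
      α * (+ 2 * γ * (+ 2 * γ)) + β * (+ 2 * γ * - β) + γ * (- β * - β)
        ≡ (β * - β - + 2 * γ * - (+ 2 * α)) * γ
    [y²] = solve-∀

InW⇒eigen : ∀ {J φ} → InW J φ → substQ φ (M J) ≡ (- det (M J)) ·Q φ
InW⇒eigen {J} {φ} φ∈W = trans φ∈W (·Q-neg (det (M J)) φ)

-i*-i≡i*i : ∀ i → (- i) * (- i) ≡ i * i
-i*-i≡i*i i = expanded i
  where
    expanded : ∀ i →
      - i * - i
        ≡ i * i
    expanded = solve-∀

InV-*Q : ∀ {J φ ψ} → InW J φ → InW J ψ → InV J (φ *Q ψ)
InV-*Q {J} {φ} {ψ} φ∈W ψ∈W =
  subst (λ k → EigenF (M J) k (φ *Q ψ)) (-i*-i≡i*i (det (M J)))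
    (EigenF-*Q {M J} { - det (M J)} { - det (M J)} {φ} {ψ} (InW⇒eigen {J} {φ} φ∈W) (InW⇒eigen {J} {ψ} ψ∈W))

InV-comb₂ : ∀ {J f g} l m n → InW J f → InW J g → InV J (comb₂ f g l m n)
InV-comb₂ {J} {f} {g} l m n f∈W g∈W =
  EigenF-+ {T} {k}
    (EigenF-+ {T} {k} (EigenF-· {T} {k} l (InV-*Q {J} {f} {f} f∈W f∈W)) (EigenF-· {T} {k} m (InV-*Q {J} {f} {g} f∈W g∈W)))
    (EigenF-· {T} {k} n (InV-*Q {J} {g} {g} g∈W g∈W))
  where
    T = M J
    k = det (M J) * det (M J)

Span₃ : Quad → Quad → Quad → Quad → Set
Span₃ a b c φ = ∃[ x ] ∃[ y ] ∃[ z ] φ ≡ ((x ·Q a) +Q (y ·Q b)) +Q (z ·Q c)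

comb₃ : Quad → Quad → Quad → ℤ → ℤ → ℤ → ℤ → ℤ → ℤ → Quart
comb₃ a b c l m n r s t = comb₂ a b l m n +F lin₃ r s t (c *Q c) (c *Q a) (c *Q b)

Sym²Span₃ : Quad → Quad → Quad → Quart → Set
Sym²Span₃ a b c F = ∃[ l ] ∃[ m ] ∃[ n ] ∃[ r ] ∃[ s ] ∃[ t ] F ≡ comb₃ a b c l m n r s t

+F-interchange : ∀ A B C D → (A +F B) +F (C +F D) ≡ (A +F C) +F (B +F D)
+F-interchange (quart F₀ F₁ F₂ F₃ F₄) (quart G₀ G₁ G₂ G₃ G₄) (quart H₀ H₁ H₂ H₃ H₄) (quart K₀ K₁ K₂ K₃ K₄) =
  congₙ 5 quart
    (coefficientwise F₀ G₀ H₀ K₀)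
    (coefficientwise F₁ G₁ H₁ K₁)
    (coefficientwise F₂ G₂ H₂ K₂)
    (coefficientwise F₃ G₃ H₃ K₃)
    (coefficientwise F₄ G₄ H₄ K₄)
  where
    coefficientwise : ∀ F₀ G₀ H₀ K₀ →
      F₀ + G₀ + (H₀ + K₀)
        ≡ F₀ + H₀ + (G₀ + K₀)
    coefficientwise = solve-∀

comb₃-+ : ∀ a b c l m n r s t l' m' n' r' s' t' →
  comb₃ a b c l m n r s t +F comb₃ a b c l' m' n' r' s' t'
    ≡ comb₃ a b c (l + l') (m + m') (n + n') (r + r') (s + s') (t + t')
comb₃-+ a b c l m n r s t l' m' n' r' s' t' =
  trans (+F-interchange (comb₂ a b l m n) (lin₃ r s t cc ca cb) (comb₂ a b l' m' n') (lin₃ r' s' t' cc ca cb))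
        (cong₂ _+F_ (comb₂-+ a b l m n l' m' n') (lin₃-+ r s t r' s' t' cc ca cb))
  where
    cc = c *Q c
    ca = c *Q a
    cb = c *Q b

comb₃-· : ∀ a b c k l m n r s t →
  k ·F comb₃ a b c l m n r s t ≡ comb₃ a b c (k * l) (k * m) (k * n) (k * r) (k * s) (k * t)
comb₃-· a b c k l m n r s t =
  trans (·F-distrib-+F k (comb₂ a b l m n) (lin₃ r s t (c *Q c) (c *Q a) (c *Q b)))
        (cong₂ _+F_ (lin₃-· k l m n (a *Q a) (a *Q b) (b *Q b)) (lin₃-· k r s t (c *Q c) (c *Q a) (c *Q b)))

span₃-*Q : ∀ a b c x y z x' y' z' →
  (((x ·Q a) +Q (y ·Q b)) +Q (z ·Q c)) *Q (((x' ·Q a) +Q (y' ·Q b)) +Q (z' ·Q c))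
    ≡ comb₃ a b c (x * x') (x * y' + y * x') (y * y') (z * z') (x * z' + z * x') (y * z' + z * y')
span₃-*Q (quad a₀ a₁ a₂) (quad b₀ b₁ b₂) (quad c₀ c₁ c₂) x y z x' y' z' =
  congₙ 5 quart
    ([x⁴,y⁴] a₀ b₀ c₀ x y z x' y' z')
    ([x³y,xy³] a₀ a₁ b₀ b₁ c₀ c₁ x y z x' y' z')
    ([x²y²] a₀ a₁ a₂ b₀ b₁ b₂ c₀ c₁ c₂ x y z x' y' z')
    ([x³y,xy³] a₁ a₂ b₁ b₂ c₁ c₂ x y z x' y' z')
    ([x⁴,y⁴] a₂ b₂ c₂ x y z x' y' z')
  where
    [x⁴,y⁴] : ∀ a₀ b₀ c₀ x y z x' y' z' →
      (x * a₀ + y * b₀ + z * c₀) * (x' * a₀ + y' * b₀ + z' * c₀)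
        ≡ x * x' * (a₀ * a₀) + (x * y' + y * x') * (a₀ * b₀) + y * y' * (b₀ * b₀) + (z * z' * (c₀ * c₀)
          + (x * z' + z * x') * (c₀ * a₀) + (y * z' + z * y') * (c₀ * b₀))
    [x⁴,y⁴] = solve-∀
    [x³y,xy³] : ∀ a₀ a₁ b₀ b₁ c₀ c₁ x y z x' y' z' →
      (x * a₀ + y * b₀ + z * c₀) * (x' * a₁ + y' * b₁ + z' * c₁) + (x * a₁ + y * b₁ + z * c₁) * (x'
        * a₀ + y' * b₀ + z' * c₀)
        ≡ x * x' * (a₀ * a₁ + a₁ * a₀) + (x * y' + y * x') * (a₀ * b₁ + a₁ * b₀) + y * y' * (b₀ * b₁
          + b₁ * b₀) + (z * z' * (c₀ * c₁ + c₁ * c₀) + (x * z' + z * x') * (c₀ * a₁ + c₁ * a₀) + (y * z' + z * y')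
          * (c₀ * b₁ + c₁ * b₀))
    [x³y,xy³] = solve-∀
    [x²y²] : ∀ a₀ a₁ a₂ b₀ b₁ b₂ c₀ c₁ c₂ x y z x' y' z' →
      (x * a₀ + y * b₀ + z * c₀) * (x' * a₂ + y' * b₂ + z' * c₂) + (x * a₁ + y * b₁ + z * c₁) * (x'
        * a₁ + y' * b₁ + z' * c₁) + (x * a₂ + y * b₂ + z * c₂) * (x' * a₀ + y' * b₀ + z' * c₀)
        ≡ x * x' * (a₀ * a₂ + a₁ * a₁ + a₂ * a₀) + (x * y' + y * x') * (a₀ * b₂ + a₁ * b₁ + a₂ * b₀)
          + y * y' * (b₀ * b₂ + b₁ * b₁ + b₂ * b₀) + (z * z' * (c₀ * c₂ + c₁ * c₁ + c₂ * c₀) + (x * z' + z * x')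
          * (c₀ * a₂ + c₁ * a₁ + c₂ * a₀) + (y * z' + z * y') * (c₀ * b₂ + c₁ * b₁ + c₂ * b₀))
    [x²y²] = solve-∀

module Sym²Span₃-closure (a b c : Quad) where

  Sym²Span₃-+ : ∀ {F G} → Sym²Span₃ a b c F → Sym²Span₃ a b c G → Sym²Span₃ a b c (F +F G)
  Sym²Span₃-+ (l , m , n , r , s , t , F≡) (l' , m' , n' , r' , s' , t' , G≡) =
    l + l' , m + m' , n + n' , r + r' , s + s' , t + t' ,
    trans (cong₂ _+F_ F≡ G≡) (comb₃-+ a b c l m n r s t l' m' n' r' s' t')

  Sym²Span₃-· : ∀ k {F} → Sym²Span₃ a b c F → Sym²Span₃ a b c (k ·F F)
  Sym²Span₃-· k (l , m , n , r , s , t , F≡) =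
    k * l , k * m , k * n , k * r , k * s , k * t , trans (cong (k ·F_) F≡) (comb₃-· a b c k l m n r s t)

  Span₃-*Q : ∀ {φ ψ} → Span₃ a b c φ → Span₃ a b c ψ → Sym²Span₃ a b c (φ *Q ψ)
  Span₃-*Q (x , y , z , φ≡) (x' , y' , z' , ψ≡) =
    x * x' , x * y' + y * x' , y * y' , z * z' , x * z' + z * x' , y * z' + z * y' ,
    trans (cong₂ _*Q_ φ≡ ψ≡) (span₃-*Q a b c x y z x' y' z')

·F-as-monomials : ∀ d K → (d * d) ·F K ≡
  ((((Quart.a K ·F ((d ·Q x²) *Q (d ·Q x²))) +F (Quart.b K ·F ((d ·Q x²) *Q (d ·Q xy))))
     +F (Quart.c K ·F ((d ·Q x²) *Q (d ·Q y²)))) +F (Quart.d K ·F ((d ·Q xy) *Q (d ·Q y²))))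
     +F (Quart.e K ·F ((d ·Q y²) *Q (d ·Q y²)))
·F-as-monomials d (quart F₀ F₁ F₂ F₃ F₄) =
  congₙ 5 quart
    ([x⁴] d F₀ F₁ F₂ F₃ F₄)
    ([x³y] d F₀ F₁ F₂ F₃ F₄)
    ([x²y²] d F₀ F₁ F₂ F₃ F₄)
    ([xy³] d F₀ F₁ F₂ F₃ F₄)
    ([y⁴] d F₀ F₁ F₂ F₃ F₄)
  where
    [x⁴] : ∀ d F₀ F₁ F₂ F₃ F₄ →
      d * d * F₀
        ≡ F₀ * (d * + 1 * (d * + 1)) + F₁ * (d * + 1 * (d * + 0)) + F₂ * (d * + 1 * (d * + 0)) + F₃
          * (d * + 0 * (d * + 0)) + F₄ * (d * + 0 * (d * + 0))
    [x⁴] = solve-∀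
    [x³y] : ∀ d F₀ F₁ F₂ F₃ F₄ →
      d * d * F₁
        ≡ F₀ * (d * + 1 * (d * + 0) + d * + 0 * (d * + 1)) + F₁ * (d * + 1 * (d * + 1) + d * + 0 * (d * + 0))
          + F₂ * (d * + 1 * (d * + 0) + d * + 0 * (d * + 0)) + F₃ * (d * + 0 * (d * + 0) + d * + 1 * (d * + 0))
          + F₄ * (d * + 0 * (d * + 0) + d * + 0 * (d * + 0))
    [x³y] = solve-∀
    [x²y²] : ∀ d F₀ F₁ F₂ F₃ F₄ →
      d * d * F₂
        ≡ F₀ * (d * + 1 * (d * + 0) + d * + 0 * (d * + 0) + d * + 0 * (d * + 1)) + F₁ * (d * + 1 * (d * + 0)
          + d * + 0 * (d * + 1) + d * + 0 * (d * + 0)) + F₂ * (d * + 1 * (d * + 1) + d * + 0 * (d * + 0)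
          + d * + 0 * (d * + 0)) + F₃ * (d * + 0 * (d * + 1) + d * + 1 * (d * + 0) + d * + 0 * (d * + 0))
          + F₄ * (d * + 0 * (d * + 1) + d * + 0 * (d * + 0) + d * + 1 * (d * + 0))
    [x²y²] = solve-∀
    [xy³] : ∀ d F₀ F₁ F₂ F₃ F₄ →
      d * d * F₃
        ≡ F₀ * (d * + 0 * (d * + 0) + d * + 0 * (d * + 0)) + F₁ * (d * + 0 * (d * + 0) + d * + 0 * (d * + 1))
          + F₂ * (d * + 0 * (d * + 1) + d * + 0 * (d * + 0)) + F₃ * (d * + 1 * (d * + 1) + d * + 0 * (d * + 0))
          + F₄ * (d * + 0 * (d * + 1) + d * + 1 * (d * + 0))
    [xy³] = solve-∀
    [y⁴] : ∀ d F₀ F₁ F₂ F₃ F₄ →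
      d * d * F₄
        ≡ F₀ * (d * + 0 * (d * + 0)) + F₁ * (d * + 0 * (d * + 0)) + F₂ * (d * + 0 * (d * + 1)) + F₃
          * (d * + 0 * (d * + 1)) + F₄ * (d * + 1 * (d * + 1))
    [y⁴] = solve-∀

Sym²Span₃-[]²· : ∀ a b c K → Sym²Span₃ a b c (([ a , b , c ] * [ a , b , c ]) ·F K)
Sym²Span₃-[]²· a b c K = subst (Sym²Span₃ a b c) (sym (·F-as-monomials δ K))
  (Sym²Span₃-+ (Sym²Span₃-+ (Sym²Span₃-+ (Sym²Span₃-+
    (Sym²Span₃-· (Quart.a K) (δ²-product x² x²)) (Sym²Span₃-· (Quart.b K) (δ²-product x² xy)))
    (Sym²Span₃-· (Quart.c K) (δ²-product x² y²))) (Sym²Span₃-· (Quart.d K) (δ²-product xy y²)))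
    (Sym²Span₃-· (Quart.e K) (δ²-product y² y²)))
  where
    open Sym²Span₃-closure a b c
    δ = [ a , b , c ]
    δ·∈Span₃ : ∀ φ → Span₃ a b c (δ ·Q φ)
    δ·∈Span₃ φ = φ ∙ (b ⨯ c) , φ ∙ (c ⨯ a) , φ ∙ (a ⨯ b) , cramer a b c φ
    δ²-product : ∀ φ ψ → Sym²Span₃ a b c ((δ ·Q φ) *Q (δ ·Q ψ))
    δ²-product φ ψ = Span₃-*Q (δ·∈Span₃ φ) (δ·∈Span₃ ψ)

w₁ w₂ w₃ : Quad → Quad
w₁ (quad α β γ) = quad β (+ 2 * γ) (+ 0)
w₂ (quad α β γ) = quad (+ 0) (+ 2 * α) β
w₃ (quad α β γ) = quad α (+ 0) (- γ)

J*J≡w₃*w₃+w₁*w₂ : ∀ J → J *Q J ≡ (w₃ J *Q w₃ J) +F (w₁ J *Q w₂ J)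
J*J≡w₃*w₃+w₁*w₂ (quad α β γ) =
  congₙ 5 quart ([x⁴] α β) ([x³y] α β γ) ([x²y²] α β γ) ([xy³] α β γ) ([y⁴] β γ)
  where
    [x⁴] : ∀ α β →
      α * α
        ≡ α * α + β * + 0
    [x⁴] = solve-∀
    [x³y] : ∀ α β γ →
      α * β + β * α
        ≡ α * + 0 + + 0 * α + (β * (+ 2 * α) + + 2 * γ * + 0)
    [x³y] = solve-∀
    [x²y²] : ∀ α β γ →
      α * γ + β * β + γ * α
        ≡ α * - γ + + 0 * + 0 + - γ * α + (β * β + + 2 * γ * (+ 2 * α) + + 0 * + 0)
    [x²y²] = solve-∀
    [xy³] : ∀ α β γ →
      β * γ + γ * β
        ≡ + 0 * - γ + - γ * + 0 + (+ 2 * γ * β + + 0 * (+ 2 * α))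
    [xy³] = solve-∀
    [y⁴] : ∀ β γ →
      γ * γ
        ≡ - γ * - γ + + 0 * β
    [y⁴] = solve-∀

ℓ∙w₁≡0 : ∀ J → ℓ J ∙ w₁ J ≡ 0ℤ
ℓ∙w₁≡0 (quad α β γ) = expanded α β γ
  where
    expanded : ∀ α β γ →
      + 2 * γ * β + - β * (+ 2 * γ) + + 2 * α * + 0
        ≡ + 0
    expanded = solve-∀

ℓ∙w₂≡0 : ∀ J → ℓ J ∙ w₂ J ≡ 0ℤ
ℓ∙w₂≡0 (quad α β γ) = expanded α β γ
  where
    expanded : ∀ α β γ →
      + 2 * γ * + 0 + - β * (+ 2 * α) + + 2 * α * β
        ≡ + 0
    expanded = solve-∀

ℓ∙w₃≡0 : ∀ J → ℓ J ∙ w₃ J ≡ 0ℤ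
ℓ∙w₃≡0 (quad α β γ) = expanded α β γ
  where
    expanded : ∀ α β γ →
      + 2 * γ * α + - β * + 0 + + 2 * α * - γ
        ≡ + 0
    expanded = solve-∀

Span₂ : Quad → Quad → Quad → Set
Span₂ f g φ = ∃[ m ] ∃[ n ] φ ≡ (m ·Q f) +Q (n ·Q g)

Sym²Span₂ : Quad → Quad → Quart → Set
Sym²Span₂ f g F = ∃[ l ] ∃[ m ] ∃[ n ] F ≡ comb₂ f g l m n

Span₂-*Q : ∀ {f g φ ψ} → Span₂ f g φ → Span₂ f g ψ → Sym²Span₂ f g (φ *Q ψ)
Span₂-*Q {f} {g} (m , n , φ≡) (m' , n' , ψ≡) =
  m * m' , m * n' + n * m' , n * n' , trans (cong₂ _*Q_ φ≡ ψ≡) (span₂-*Q f g m n m' n')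

Sym²Span₂-+ : ∀ {f g F G} → Sym²Span₂ f g F → Sym²Span₂ f g G → Sym²Span₂ f g (F +F G)
Sym²Span₂-+ {f} {g} (l , m , n , F≡) (l' , m' , n' , G≡) =
  l + l' , m + m' , n + n' , trans (cong₂ _+F_ F≡ G≡) (comb₂-+ f g l m n l' m' n')

J*J∈Sym²Span₂ : ∀ {J f g} → (∀ φ → InW J φ → Span₂ f g φ) → Sym²Span₂ f g (J *Q J)
J*J∈Sym²Span₂ {J} {f} {g} W⊆span = subst (Sym²Span₂ f g) (sym (J*J≡w₃*w₃+w₁*w₂ J))
  (Sym²Span₂-+ {f} {g} {w₃ J *Q w₃ J} {w₁ J *Q w₂ J}
    (Span₂-*Q {f} {g} {w₃ J} {w₃ J} w₃∈span w₃∈span) (Span₂-*Q {f} {g} {w₁ J} {w₂ J} w₁∈span w₂∈span))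
  where
    w₁∈span = W⊆span (w₁ J) (⟂ℓ⇒InW J (w₁ J) (ℓ∙w₁≡0 J))
    w₂∈span = W⊆span (w₂ J) (⟂ℓ⇒InW J (w₂ J) (ℓ∙w₂≡0 J))
    w₃∈span = W⊆span (w₃ J) (⟂ℓ⇒InW J (w₃ J) (ℓ∙w₃≡0 J))

+F-identityʳ : ∀ F → F +F 0F ≡ F
+F-identityʳ (quart F₀ F₁ F₂ F₃ F₄) =
  congₙ 5 quart
    (coefficientwise F₀)
    (coefficientwise F₁)
    (coefficientwise F₂)
    (coefficientwise F₃)
    (coefficientwise F₄)
  where
    coefficientwise : ∀ F₀ →
      F₀ + + 0
        ≡ F₀
    coefficientwise = solve-∀

lin₃-absorb : ∀ l m n r s t p q r' A B C X Y →
  lin₃ l m n A B C +F lin₃ r s t (lin₃ p q r' A B C) X Y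
    ≡ lin₃ (l + r * p) (m + r * q) (n + r * r') A B C +F ((s ·F X) +F (t ·F Y))
lin₃-absorb l m n r s t p q r'
            (quart F₀ F₁ F₂ F₃ F₄) (quart G₀ G₁ G₂ G₃ G₄) (quart H₀ H₁ H₂ H₃ H₄) (quart K₀ K₁ K₂ K₃ K₄) (quart L₀ L₁ L₂ L₃ L₄) =
  congₙ 5 quart
    (coefficientwise l m n r s t p q r' F₀ G₀ H₀ K₀ L₀)
    (coefficientwise l m n r s t p q r' F₁ G₁ H₁ K₁ L₁)
    (coefficientwise l m n r s t p q r' F₂ G₂ H₂ K₂ L₂)
    (coefficientwise l m n r s t p q r' F₃ G₃ H₃ K₃ L₃)
    (coefficientwise l m n r s t p q r' F₄ G₄ H₄ K₄ L₄)
  where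
    coefficientwise : ∀ l m n r s t p q r' F₀ G₀ H₀ K₀ L₀ →
      l * F₀ + m * G₀ + n * H₀ + (r * (p * F₀ + q * G₀ + r' * H₀) + s * K₀ + t * L₀)
        ≡ (l + r * p) * F₀ + (m + r * q) * G₀ + (n + r * r') * H₀ + (s * K₀ + t * L₀)
    coefficientwise = solve-∀

comb₃-absorb : ∀ f g c l m n r s t p q r' → c *Q c ≡ comb₂ f g p q r' →
  comb₃ f g c l m n r s t ≡ comb₂ f g (l + r * p) (m + r * q) (n + r * r') +F ((s ·F (c *Q f)) +F (t ·F (c *Q g)))
comb₃-absorb f g c l m n r s t p q r' c*c≡ =
  trans (cong (λ X → comb₂ f g l m n +F lin₃ r s t X (c *Q f) (c *Q g)) c*c≡)
        (lin₃-absorb l m n r s t p q r' (f *Q f) (f *Q g) (g *Q g) (c *Q f) (c *Q g))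

i*i≢0 : ∀ {i} → i ≢ 0ℤ → i * i ≢ 0ℤ
i*i≢0 {i} i≢0 i*i≡0 = Sum.[ i≢0 , i≢0 ] (ℤ.i*j≡0⇒i≡0∨j≡0 i i*i≡0)

J*W-anti-invariant : ∀ {J φ} → InW J φ → EigenF (M J) (det (M J) * (- det (M J))) (J *Q φ)
J*W-anti-invariant {J} {φ} φ∈W =
  EigenF-*Q {M J} {det (M J)} { - det (M J)} {J} {φ} (J-eigen J) (InW⇒eigen {J} {φ} φ∈W)

anti-invariant-part-vanishes : ∀ {J F ρ} → det (M J) ≢ 0ℤ → InV J F → InV J (F +F ρ) →
  EigenF (M J) (det (M J) * (- det (M J))) ρ → ρ ≡ 0F
anti-invariant-part-vanishes {J} {F} {ρ} d≢0 F∈V F+ρ∈V ρ-anti =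
  EigenF-unique {M J} {d * d} {d * (- d)} {ρ} d*d≢d*-d (EigenF-cancelˡ {M J} {d * d} {F} {ρ} F∈V F+ρ∈V) ρ-anti
  where
    d = det (M J)
    d*d≢d*-d : d * d ≢ d * (- d)
    d*d≢d*-d eq = i≢0⇒i≢-i (i*i≢0 d≢0) (trans eq (sym (ℤ.neg-distribʳ-* d d)))

[f,g,J]²K∈Sym²Span₂ : ∀ {J f g K} → det (M J) ≢ 0ℤ → InW J f → InW J g → (∀ φ → InW J φ → Span₂ f g φ) →
  InV J K → Sym²Span₂ f g (([ f , g , J ] * [ f , g , J ]) ·F K)
[f,g,J]²K∈Sym²Span₂ {J} {f} {g} {K} d≢0 f∈W g∈W W⊆span K∈V =
  absorb (Sym²Span₃-[]²· f g J K) (J*J∈Sym²Span₂ {J} {f} {g} W⊆span)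
  where
    δ = [ f , g , J ]
    anti = det (M J) * (- det (M J))
    absorb : Sym²Span₃ f g J ((δ * δ) ·F K) → Sym²Span₂ f g (J *Q J) → Sym²Span₂ f g ((δ * δ) ·F K)
    absorb (l , m , n , r , s , t , δ²K≡) (p , q , r' , J*J≡) =
      l + r * p , m + r * q , n + r * r' , trans δ²K≡A+ρ (trans (cong (A +F_) ρ≡0) (+F-identityʳ A))
      where
        A = comb₂ f g (l + r * p) (m + r * q) (n + r * r')
        ρ = (s ·F (J *Q f)) +F (t ·F (J *Q g))
        δ²K≡A+ρ : (δ * δ) ·F K ≡ A +F ρ
        δ²K≡A+ρ = trans δ²K≡ (comb₃-absorb f g J l m n r s t p q r' J*J≡)
        A+ρ∈V : InV J (A +F ρ)
        A+ρ∈V = subst (InV J) δ²K≡A+ρ (EigenF-· {M J} {det (M J) * det (M J)} (δ * δ) {K} K∈V)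
        ρ-anti : EigenF (M J) anti ρ
        ρ-anti = EigenF-+ {M J} {anti} (EigenF-· {M J} {anti} s (J*W-anti-invariant {J} {f} f∈W))
                                       (EigenF-· {M J} {anti} t (J*W-anti-invariant {J} {g} g∈W))
        ρ≡0 : ρ ≡ 0F
        ρ≡0 = anti-invariant-part-vanishes {J} {A} {ρ} d≢0
                (InV-comb₂ {J} {f} {g} (l + r * p) (m + r * q) (n + r * r') f∈W g∈W) A+ρ∈V ρ-anti

_∣Q_ : ℤ → Quad → Set
k ∣Q φ = k ∣ Quad.a φ × k ∣ Quad.b φ × k ∣ Quad.c φ

_∣F_ : ℤ → Quart → Set
k ∣F F = k ∣ Quart.a F × k ∣ Quart.b F × k ∣ Quart.c F × k ∣ Quart.d F × k ∣ Quart.e F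

∣F-+ : ∀ {k F G} → k ∣F F → k ∣F G → k ∣F (F +F G)
∣F-+ (a , b , c , d , e) (a' , b' , c' , d' , e') =
  ∣m∣n⇒∣m+n a a' , ∣m∣n⇒∣m+n b b' , ∣m∣n⇒∣m+n c c' , ∣m∣n⇒∣m+n d d' , ∣m∣n⇒∣m+n e e'

∣F-· : ∀ {k} c {F} → k ∣F F → k ∣F (c ·F F)
∣F-· c (a , b , d , e , f) = ∣n⇒∣m*n c a , ∣n⇒∣m*n c b , ∣n⇒∣m*n c d , ∣n⇒∣m*n c e , ∣n⇒∣m*n c f

·-∣F : ∀ {k c} F → k ∣ c → k ∣F (c ·F F)
·-∣F (quart a b c d e) k∣c = ∣m⇒∣m*n a k∣c , ∣m⇒∣m*n b k∣c , ∣m⇒∣m*n c k∣c , ∣m⇒∣m*n d k∣c , ∣m⇒∣m*n e k∣c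

reverseQ : Quad → Quad
reverseQ (quad a b c) = quad c b a

reverseF : Quart → Quart
reverseF (quart a b c d e) = quart e d c b a

∣Q-reverse : ∀ {k φ} → k ∣Q φ → k ∣Q reverseQ φ
∣Q-reverse (a , b , c) = c , b , a

∣F-reverse : ∀ {k F} → k ∣F F → k ∣F reverseF F
∣F-reverse (a , b , c , d , e) = e , d , c , b , a

reverseF-*Q : ∀ φ ψ → reverseF (φ *Q ψ) ≡ reverseQ φ *Q reverseQ ψ
reverseF-*Q (quad a₀ a₁ a₂) (quad b₀ b₁ b₂) =
  congₙ 5 quart refl ([x³y,xy³] a₁ a₂ b₁ b₂) ([x²y²] a₀ a₁ a₂ b₀ b₁ b₂) ([x³y,xy³] a₀ a₁ b₀ b₁) refl
  where
    [x³y,xy³] : ∀ a₁ a₂ b₁ b₂ →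
      a₁ * b₂ + a₂ * b₁
        ≡ a₂ * b₁ + a₁ * b₂
    [x³y,xy³] = solve-∀
    [x²y²] : ∀ a₀ a₁ a₂ b₀ b₁ b₂ →
      a₀ * b₂ + a₁ * b₁ + a₂ * b₀
        ≡ a₂ * b₀ + a₁ * b₁ + a₀ * b₂
    [x²y²] = solve-∀

*Q-comm : ∀ φ ψ → φ *Q ψ ≡ ψ *Q φ
*Q-comm (quad a₀ a₁ a₂) (quad b₀ b₁ b₂) =
  congₙ 5 quart
    ([x⁴,y⁴] a₀ b₀)
    ([x³y,xy³] a₀ a₁ b₀ b₁)
    ([x²y²] a₀ a₁ a₂ b₀ b₁ b₂)
    ([x³y,xy³] a₁ a₂ b₁ b₂)
    ([x⁴,y⁴] a₂ b₂)
  where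
    [x⁴,y⁴] : ∀ a₀ b₀ →
      a₀ * b₀
        ≡ b₀ * a₀
    [x⁴,y⁴] = solve-∀
    [x³y,xy³] : ∀ a₀ a₁ b₀ b₁ →
      a₀ * b₁ + a₁ * b₀
        ≡ b₀ * a₁ + b₁ * a₀
    [x³y,xy³] = solve-∀
    [x²y²] : ∀ a₀ a₁ a₂ b₀ b₁ b₂ →
      a₀ * b₂ + a₁ * b₁ + a₂ * b₀
        ≡ b₀ * a₂ + b₁ * a₁ + b₂ * a₀
    [x²y²] = solve-∀

module _ {p : ℕ} (p-prime : Prime p) where

  private
    P = + p

  prime∣*⇒∣⊎∣ : ∀ x y → P ∣ x * y → P ∣ x ⊎ P ∣ y
  prime∣*⇒∣⊎∣ x y P∣xy = Sum.map ∣ᵤ⇒∣ ∣ᵤ⇒∣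
    (euclidsLemma ℤ.∣ x ∣ ℤ.∣ y ∣ p-prime (subst (p ℕ.∣_) (ℤ.abs-* x y) (∣⇒∣ᵤ P∣xy)))

  prime∣*∤ˡ : ∀ {x y} → ¬ P ∣ x → P ∣ x * y → P ∣ y
  prime∣*∤ˡ {x} {y} P∤x P∣xy = Sum.[ (λ P∣x → ⊥-elim (P∤x P∣x)) , (λ P∣y → P∣y) ] (prime∣*⇒∣⊎∣ x y P∣xy)

  prime∣*∤ʳ : ∀ {x y} → ¬ P ∣ y → P ∣ x * y → P ∣ x
  prime∣*∤ʳ {x} {y} P∤y P∣xy = Sum.[ (λ P∣x → P∣x) , (λ P∣y → ⊥-elim (P∤y P∣y)) ] (prime∣*⇒∣⊎∣ x y P∣xy)

  prime∤1 : ¬ P ∣ + 1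
  prime∤1 P∣1 = ¬prime[1] (subst Prime (ℕ.∣1⇒≡1 (∣⇒∣ᵤ P∣1)) p-prime)

  prime≢0 : P ≢ 0ℤ
  prime≢0 P≡0 = ¬prime[0] (subst Prime (ℤ.+-injective P≡0) p-prime)

  prime∤a⇒∣Q : ∀ φ ψ → ¬ P ∣ Quad.a φ → P ∣F (φ *Q ψ) → P ∣Q ψ
  prime∤a⇒∣Q (quad a b c) (quad d e f) P∤a (h₀ , h₁ , h₂ , _) = P∣d , P∣e , P∣f
    where
      P∣d = prime∣*∤ˡ P∤a h₀
      P∣e = prime∣*∤ˡ P∤a (∣m+n∣n⇒∣m h₁ (∣n⇒∣m*n b P∣d))
      P∣f = prime∣*∤ˡ P∤a (∣m+n∣n⇒∣m (∣m+n∣n⇒∣m h₂ (∣n⇒∣m*n c P∣d)) (∣n⇒∣m*n b P∣e))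

  prime∣*Q⇒∣⊎∣ : ∀ φ ψ → P ∣F (φ *Q ψ) → P ∣Q φ ⊎ P ∣Q ψ
  prime∣*Q⇒∣⊎∣ φ@(quad a b c) ψ@(quad d e f) h with P ∣? a | P ∣? c | P ∣? d | P ∣? f
  ... | no P∤a | _ | _ | _ = inj₂ (prime∤a⇒∣Q φ ψ P∤a h)
  ... | _ | no P∤c | _ | _ =
    inj₂ (∣Q-reverse (prime∤a⇒∣Q (reverseQ φ) (reverseQ ψ) P∤c (subst (P ∣F_) (reverseF-*Q φ ψ) (∣F-reverse h))))
  ... | _ | _ | no P∤d | _ = inj₁ (prime∤a⇒∣Q ψ φ P∤d (subst (P ∣F_) (*Q-comm φ ψ) h))
  ... | _ | _ | _ | no P∤f =
    inj₁ (∣Q-reverse (prime∤a⇒∣Q (reverseQ ψ) (reverseQ φ) P∤f (subst (P ∣F_) (reverseF-*Q ψ φ) (∣F-reverse (subst (P ∣F_) (*Q-comm φ ψ) h)))))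
  ... | yes P∣a | yes P∣c | yes P∣d | yes P∣f =
    Sum.map (λ P∣b → P∣a , P∣b , P∣c) (λ P∣e → P∣d , P∣e , P∣f) (prime∣*⇒∣⊎∣ b e P∣be)
    where
      P∣be = ∣m+n∣m⇒∣n (∣m+n∣n⇒∣m (proj₁ (proj₂ (proj₂ h))) (∣n⇒∣m*n c P∣d)) (∣m⇒∣m*n f P∣a)

  prime∤*∤ : ∀ {x y} → ¬ P ∣ x → ¬ P ∣ y → ¬ P ∣ x * y
  prime∤*∤ {x} {y} P∤x P∤y P∣xy = Sum.[ P∤x , P∤y ] (prime∣*⇒∣⊎∣ x y P∣xy)

IndependentMod : ℕ → Quad → Quad → Set
IndependentMod p f g = ∀ s t → (+ p) ∣Q ((s ·Q f) +Q (t ·Q g)) → (+ p) ∣ s × (+ p) ∣ t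

+Q-comm : ∀ φ ψ → φ +Q ψ ≡ ψ +Q φ
+Q-comm (quad a₀ a₁ a₂) (quad b₀ b₁ b₂) =
  congₙ 3 quad (coefficientwise a₀ b₀) (coefficientwise a₁ b₁) (coefficientwise a₂ b₂)
  where
    coefficientwise : ∀ a₀ b₀ →
      a₀ + b₀
        ≡ b₀ + a₀
    coefficientwise = solve-∀

IndependentMod-swap : ∀ {p f g} → IndependentMod p f g → IndependentMod p g f
IndependentMod-swap {p} {f} {g} ind s t p∣sg+tf = swap (ind t s (subst ((+ p) ∣Q_) (+Q-comm (s ·Q g) (t ·Q f)) p∣sg+tf))

IndependentMod-reverse : ∀ {p f g} → IndependentMod p f g → IndependentMod p (reverseQ f) (reverseQ g)
IndependentMod-reverse ind s t p∣ = ind s t (∣Q-reverse p∣)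

comb₂-swap : ∀ f g l m n → comb₂ g f n m l ≡ comb₂ f g l m n
comb₂-swap (quad a₀ a₁ a₂) (quad b₀ b₁ b₂) l m n =
  congₙ 5 quart
    ([x⁴,y⁴] a₀ b₀ l m n)
    ([x³y,xy³] a₀ a₁ b₀ b₁ l m n)
    ([x²y²] a₀ a₁ a₂ b₀ b₁ b₂ l m n)
    ([x³y,xy³] a₁ a₂ b₁ b₂ l m n)
    ([x⁴,y⁴] a₂ b₂ l m n)
  where
    [x⁴,y⁴] : ∀ a₀ b₀ l m n →
      n * (b₀ * b₀) + m * (b₀ * a₀) + l * (a₀ * a₀)
        ≡ l * (a₀ * a₀) + m * (a₀ * b₀) + n * (b₀ * b₀)
    [x⁴,y⁴] = solve-∀
    [x³y,xy³] : ∀ a₀ a₁ b₀ b₁ l m n →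
      n * (b₀ * b₁ + b₁ * b₀) + m * (b₀ * a₁ + b₁ * a₀) + l * (a₀ * a₁ + a₁ * a₀)
        ≡ l * (a₀ * a₁ + a₁ * a₀) + m * (a₀ * b₁ + a₁ * b₀) + n * (b₀ * b₁ + b₁ * b₀)
    [x³y,xy³] = solve-∀
    [x²y²] : ∀ a₀ a₁ a₂ b₀ b₁ b₂ l m n →
      n * (b₀ * b₂ + b₁ * b₁ + b₂ * b₀) + m * (b₀ * a₂ + b₁ * a₁ + b₂ * a₀) + l * (a₀ * a₂ + a₁ * a₁
        + a₂ * a₀)
        ≡ l * (a₀ * a₂ + a₁ * a₁ + a₂ * a₀) + m * (a₀ * b₂ + a₁ * b₁ + a₂ * b₀) + n * (b₀ * b₂ + b₁
          * b₁ + b₂ * b₀)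
    [x²y²] = solve-∀

comb₂-reverse : ∀ f g l m n → comb₂ (reverseQ f) (reverseQ g) l m n ≡ reverseF (comb₂ f g l m n)
comb₂-reverse (quad a₀ a₁ a₂) (quad b₀ b₁ b₂) l m n =
  congₙ 5 quart
    refl
    ([x³y,xy³] a₁ a₂ b₁ b₂ l m n)
    ([x²y²] a₀ a₁ a₂ b₀ b₁ b₂ l m n)
    ([x³y,xy³] a₀ a₁ b₀ b₁ l m n)
    refl
  where
    [x³y,xy³] : ∀ a₁ a₂ b₁ b₂ l m n →
      l * (a₂ * a₁ + a₁ * a₂) + m * (a₂ * b₁ + a₁ * b₂) + n * (b₂ * b₁ + b₁ * b₂)
        ≡ l * (a₁ * a₂ + a₂ * a₁) + m * (a₁ * b₂ + a₂ * b₁) + n * (b₁ * b₂ + b₂ * b₁)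
    [x³y,xy³] = solve-∀
    [x²y²] : ∀ a₀ a₁ a₂ b₀ b₁ b₂ l m n →
      l * (a₂ * a₀ + a₁ * a₁ + a₀ * a₂) + m * (a₂ * b₀ + a₁ * b₁ + a₀ * b₂) + n * (b₂ * b₀ + b₁ * b₁
        + b₀ * b₂)
        ≡ l * (a₀ * a₂ + a₁ * a₁ + a₂ * a₀) + m * (a₀ * b₂ + a₁ * b₁ + a₂ * b₀) + n * (b₀ * b₂ + b₁
          * b₁ + b₂ * b₀)
    [x²y²] = solve-∀

-- Completing the square: u = a'f − ag has no x²-term, and modulo p the last term vanishes.
completing-the-square : ∀ f g l m n → let a = Quad.a f; a' = Quad.a g in
  ((a' ·Q f) +Q ((- a) ·Q g)) *Q (((l * a') ·Q f) +Q ((l * a + m * a') ·Q g))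
    ≡ ((a' * a') ·F comb₂ f g l m n) +F ((- Quart.a (comb₂ f g l m n)) ·F (g *Q g))
completing-the-square (quad a₀ a₁ a₂) (quad b₀ b₁ b₂) l m n =
  congₙ 5 quart
    ([x⁴] a₀ b₀ l m n)
    ([x³y] a₀ a₁ b₀ b₁ l m n)
    ([x²y²] a₀ a₁ a₂ b₀ b₁ b₂ l m n)
    ([xy³] a₀ a₁ a₂ b₀ b₁ b₂ l m n)
    ([y⁴] a₀ a₂ b₀ b₂ l m n)
  where
    [x⁴] : ∀ a₀ b₀ l m n →
      (b₀ * a₀ + - a₀ * b₀) * (l * b₀ * a₀ + (l * a₀ + m * b₀) * b₀)
        ≡ b₀ * b₀ * (l * (a₀ * a₀) + m * (a₀ * b₀) + n * (b₀ * b₀)) + - (l * (a₀ * a₀) + m * (a₀ * b₀)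
          + n * (b₀ * b₀)) * (b₀ * b₀)
    [x⁴] = solve-∀
    [x³y] : ∀ a₀ a₁ b₀ b₁ l m n →
      (b₀ * a₀ + - a₀ * b₀) * (l * b₀ * a₁ + (l * a₀ + m * b₀) * b₁) + (b₀ * a₁ + - a₀ * b₁) * (l * b₀
        * a₀ + (l * a₀ + m * b₀) * b₀)
        ≡ b₀ * b₀ * (l * (a₀ * a₁ + a₁ * a₀) + m * (a₀ * b₁ + a₁ * b₀) + n * (b₀ * b₁ + b₁ * b₀)) +
          - (l * (a₀ * a₀) + m * (a₀ * b₀) + n * (b₀ * b₀)) * (b₀ * b₁ + b₁ * b₀)
    [x³y] = solve-∀
    [x²y²] : ∀ a₀ a₁ a₂ b₀ b₁ b₂ l m n →
      (b₀ * a₀ + - a₀ * b₀) * (l * b₀ * a₂ + (l * a₀ + m * b₀) * b₂) + (b₀ * a₁ + - a₀ * b₁) * (l * b₀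
        * a₁ + (l * a₀ + m * b₀) * b₁) + (b₀ * a₂ + - a₀ * b₂) * (l * b₀ * a₀ + (l * a₀ + m * b₀) * b₀)
        ≡ b₀ * b₀ * (l * (a₀ * a₂ + a₁ * a₁ + a₂ * a₀) + m * (a₀ * b₂ + a₁ * b₁ + a₂ * b₀) + n * (b₀ * b₂ + b₁
          * b₁ + b₂ * b₀)) + - (l * (a₀ * a₀) + m * (a₀ * b₀) + n * (b₀ * b₀)) * (b₀ * b₂ + b₁ * b₁ + b₂
          * b₀)
    [x²y²] = solve-∀
    [xy³] : ∀ a₀ a₁ a₂ b₀ b₁ b₂ l m n →
      (b₀ * a₁ + - a₀ * b₁) * (l * b₀ * a₂ + (l * a₀ + m * b₀) * b₂) + (b₀ * a₂ + - a₀ * b₂) * (l * b₀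
        * a₁ + (l * a₀ + m * b₀) * b₁)
        ≡ b₀ * b₀ * (l * (a₁ * a₂ + a₂ * a₁) + m * (a₁ * b₂ + a₂ * b₁) + n * (b₁ * b₂ + b₂ * b₁)) +
          - (l * (a₀ * a₀) + m * (a₀ * b₀) + n * (b₀ * b₀)) * (b₁ * b₂ + b₂ * b₁)
    [xy³] = solve-∀
    [y⁴] : ∀ a₀ a₂ b₀ b₂ l m n →
      (b₀ * a₂ + - a₀ * b₂) * (l * b₀ * a₂ + (l * a₀ + m * b₀) * b₂)
        ≡ b₀ * b₀ * (l * (a₂ * a₂) + m * (a₂ * b₂) + n * (b₂ * b₂)) + - (l * (a₀ * a₀) + m * (a₀ * b₀)
          + n * (b₀ * b₀)) * (b₂ * b₂)
    [y⁴] = solve-∀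

b'b-bb'≡0 : ∀ b b' → b' * b + (- b) * b' ≡ 0ℤ
b'b-bb'≡0 b b' = expanded b b'
  where
    expanded : ∀ b b' →
      b' * b + - b * b'
        ≡ + 0
    expanded = solve-∀

reverse₃ : ∀ {A B C : Set} → A × B × C → C × B × A
reverse₃ (x , y , z) = z , y , x

module _ {p : ℕ} (p-prime : Prime p) (f g : Quad) (ind : IndependentMod p f g) where

  private
    P = + p

  comb₂-mod-prime-∤a' : ∀ {l m n} → ¬ P ∣ Quad.a g → P ∣F comb₂ f g l m n → P ∣ l × P ∣ m × P ∣ n
  comb₂-mod-prime-∤a' {l} {m} {n} P∤a' P∣comb₂ =
    cases (prime∣*Q⇒∣⊎∣ p-prime u v P∣u*v)
    where
      a  = Quad.a f
      a' = Quad.a g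
      u  = (a' ·Q f) +Q ((- a) ·Q g)
      v  = ((l * a') ·Q f) +Q ((l * a + m * a') ·Q g)
      P∣u*v : P ∣F (u *Q v)
      P∣u*v = subst (P ∣F_) (sym (completing-the-square f g l m n))
                (∣F-+ {P} {(a' * a') ·F comb₂ f g l m n} (∣F-· (a' * a') {comb₂ f g l m n} P∣comb₂)
                      (·-∣F (g *Q g) (∣m⇒∣-m (proj₁ P∣comb₂))))
      cases : P ∣Q u ⊎ P ∣Q v → P ∣ l × P ∣ m × P ∣ n
      cases (inj₁ P∣u) = ⊥-elim (P∤a' (proj₁ (ind a' (- a) P∣u)))
      cases (inj₂ P∣v) = P∣l , P∣m , P∣n
        where
          P∣l = prime∣*∤ʳ p-prime P∤a' (proj₁ (ind (l * a') (l * a + m * a') P∣v))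
          P∣m = prime∣*∤ʳ p-prime P∤a' (∣m+n∣m⇒∣n (proj₂ (ind (l * a') (l * a + m * a') P∣v)) (∣m⇒∣m*n a P∣l))
          P∣n = prime∣*∤ʳ p-prime (prime∤*∤ p-prime P∤a' P∤a')
                  (∣m+n∣m⇒∣n (proj₁ P∣comb₂) (∣m∣n⇒∣m+n (∣m⇒∣m*n (a * a) P∣l) (∣m⇒∣m*n (a * a') P∣m)))

module _ {p : ℕ} (p-prime : Prime p) where

  private
    P = + p

  IndependentMod⇒∤outer : ∀ f g → IndependentMod p f g →
    ¬ P ∣ Quad.a g ⊎ ¬ P ∣ Quad.a f ⊎ ¬ P ∣ Quad.c g ⊎ ¬ P ∣ Quad.c f
  IndependentMod⇒∤outer f@(quad a b c) g@(quad a' b' c') ind with P ∣? a' | P ∣? a | P ∣? c' | P ∣? c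
  ... | no P∤a' | _       | _        | _       = inj₁ P∤a'
  ... | yes _   | no P∤a  | _        | _       = inj₂ (inj₁ P∤a)
  ... | yes _   | yes _   | no P∤c'  | _       = inj₂ (inj₂ (inj₁ P∤c'))
  ... | yes _   | yes _   | yes _    | no P∤c  = inj₂ (inj₂ (inj₂ P∤c))
  ... | yes P∣a' | yes P∣a | yes P∣c' | yes P∣c = ⊥-elim (prime∤1 p-prime (proj₁ (ind (+ 1) (+ 0) P∣1·f+0·g)))
    where
      -- Both forms are multiples of xy modulo p, so b'f − bg vanishes modulo p.
      P∣b'f-bg : P ∣Q ((b' ·Q f) +Q ((- b) ·Q g))
      P∣b'f-bg = ∣m∣n⇒∣m+n (∣n⇒∣m*n b' P∣a) (∣n⇒∣m*n (- b) P∣a')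
               , subst (P ∣_) (sym (b'b-bb'≡0 b b')) (divides 0ℤ refl)
               , ∣m∣n⇒∣m+n (∣n⇒∣m*n b' P∣c) (∣n⇒∣m*n (- b) P∣c')
      P∣b : P ∣ b
      P∣b = subst (P ∣_) (ℤ.neg-involutive b) (∣m⇒∣-m (proj₂ (ind b' (- b) P∣b'f-bg)))
      P∣1·f+0·g : P ∣Q (((+ 1) ·Q f) +Q ((+ 0) ·Q g))
      P∣1·f+0·g = subst (P ∣Q_) (sym (1·φ+0·ψ≡φ f g)) (P∣a , P∣b , P∣c)

  comb₂-mod-prime : ∀ f g {l m n} → IndependentMod p f g → P ∣F comb₂ f g l m n → P ∣ l × P ∣ m × P ∣ n
  comb₂-mod-prime f g {l} {m} {n} ind P∣comb₂ = cases (IndependentMod⇒∤outer f g ind)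
    where
      P∣rev : P ∣F comb₂ (reverseQ f) (reverseQ g) l m n
      P∣rev = subst (P ∣F_) (sym (comb₂-reverse f g l m n)) (∣F-reverse P∣comb₂)
      cases : ¬ P ∣ Quad.a g ⊎ ¬ P ∣ Quad.a f ⊎ ¬ P ∣ Quad.c g ⊎ ¬ P ∣ Quad.c f → P ∣ l × P ∣ m × P ∣ n
      cases (inj₁ P∤a') = comb₂-mod-prime-∤a' p-prime f g ind P∤a' P∣comb₂
      cases (inj₂ (inj₁ P∤a)) = reverse₃ (comb₂-mod-prime-∤a' p-prime g f (IndependentMod-swap ind) P∤a
        (subst (P ∣F_) (sym (comb₂-swap f g l m n)) P∣comb₂))
      cases (inj₂ (inj₂ (inj₁ P∤c'))) =
        comb₂-mod-prime-∤a' p-prime (reverseQ f) (reverseQ g) (IndependentMod-reverse ind) P∤c' P∣rev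
      cases (inj₂ (inj₂ (inj₂ P∤c))) = reverse₃ (comb₂-mod-prime-∤a' p-prime (reverseQ g) (reverseQ f)
        (IndependentMod-swap (IndependentMod-reverse ind)) P∤c
        (subst (P ∣F_) (sym (comb₂-swap (reverseQ f) (reverseQ g) l m n)) P∣rev))

·F-cancelˡ : ∀ {k F G} → k ≢ 0ℤ → k ·F F ≡ k ·F G → F ≡ G
·F-cancelˡ {k} {quart _ _ _ _ _} {quart _ _ _ _ _} k≢0 eq =
  congₙ 5 quart (cancel (cong Quart.a eq)) (cancel (cong Quart.b eq)) (cancel (cong Quart.c eq))
                (cancel (cong Quart.d eq)) (cancel (cong Quart.e eq))
  where
    cancel : ∀ {x y} → k * x ≡ k * y → x ≡ y
    cancel {x} {y} = ℤ.*-cancelˡ-≡ k x y {{ℤ.≢-nonZero k≢0}}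

comb₂-·ʳ : ∀ f g l m n k → comb₂ f g (l * k) (m * k) (n * k) ≡ k ·F comb₂ f g l m n
comb₂-·ʳ f g l m n k = lin₃-·ʳ l m n k (f *Q f) (f *Q g) (g *Q g)

·F-·F : ∀ k k' F → k ·F (k' ·F F) ≡ (k * k') ·F F
·F-·F k k' (quart F₀ F₁ F₂ F₃ F₄) =
  congₙ 5 quart
    (coefficientwise k k' F₀)
    (coefficientwise k k' F₁)
    (coefficientwise k k' F₂)
    (coefficientwise k k' F₃)
    (coefficientwise k k' F₄)
  where
    coefficientwise : ∀ k k' F₀ →
      k * (k' * F₀)
        ≡ k * k' * F₀
    coefficientwise = solve-∀

1·F : ∀ F → (+ 1) ·F F ≡ F
1·F (quart F₀ F₁ F₂ F₃ F₄) =
  congₙ 5 quart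
    (coefficientwise F₀)
    (coefficientwise F₁)
    (coefficientwise F₂)
    (coefficientwise F₃)
    (coefficientwise F₄)
  where
    coefficientwise : ∀ F₀ →
      + 1 * F₀
        ≡ F₀
    coefficientwise = solve-∀

comb₂-divide : ∀ {p} → Prime p → ∀ {f g} → IndependentMod p f g → ∀ {K l m n} → (+ p) ·F K ≡ comb₂ f g l m n →
  ∃[ l' ] ∃[ m' ] ∃[ n' ] (l ≡ l' * + p × m ≡ m' * + p × n ≡ n' * + p) × K ≡ comb₂ f g l' m' n'
comb₂-divide {p} p-prime {f} {g} ind {K} {l} {m} {n} pK≡comb₂ =
  divide (comb₂-mod-prime p-prime f g ind (subst ((+ p) ∣F_) pK≡comb₂ (·-∣F K (∣-refl {+ p}))))
  where
    divide : (+ p) ∣ l × (+ p) ∣ m × (+ p) ∣ n → _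
    divide (divides l' l≡ , divides m' m≡ , divides n' n≡) = l' , m' , n' , (l≡ , m≡ , n≡) ,
      ·F-cancelˡ (prime≢0 p-prime) (begin
        (+ p) ·F K                                   ≡⟨ pK≡comb₂ ⟩
        comb₂ f g l m n                               ≡⟨ congₙ 3 (comb₂ f g) l≡ m≡ n≡ ⟩
        comb₂ f g (l' * + p) (m' * + p) (n' * + p)    ≡⟨ comb₂-·ʳ f g l' m' n' (+ p) ⟩
        (+ p) ·F comb₂ f g l' m' n'                   ∎)

descent : ∀ {f g} → (∀ {p} → Prime p → IndependentMod p f g) → ∀ ps → All Prime ps →
  ∀ {K l m n} → (+ product ps) ·F K ≡ comb₂ f g l m n → Sym²Span₂ f g K
descent ind [] [] {K} {l} {m} {n} K≡comb₂ = l , m , n , trans (sym (1·F K)) K≡comb₂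
descent {f} {g} ind (p ∷ ps) (p-prime ∷ ps-prime) {K} {l} {m} {n} K≡comb₂ =
  continue (comb₂-divide p-prime (ind p-prime) {(+ product ps) ·F K} {l} {m} {n} (trans (·F-·F (+ p) (+ product ps) K)
    (trans (cong (_·F K) (sym (ℤ.pos-* p (product ps)))) K≡comb₂)))
  where
    continue : (∃[ l' ] ∃[ m' ] ∃[ n' ] (l ≡ l' * + p × m ≡ m' * + p × n ≡ n' * + p) × (+ product ps) ·F K ≡ comb₂ f g l' m' n') →
               Sym²Span₂ f g K
    continue (l' , m' , n' , _ , K≡comb₂') = descent ind ps ps-prime {K} {l'} {m'} {n'} K≡comb₂'

square-as-ℕ : ∀ i → i ≢ 0ℤ → ∃[ n ] ℕ.NonZero n × i * i ≡ + n
square-as-ℕ +0         i≢0 = ⊥-elim (i≢0 refl)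
square-as-ℕ +[1+ k ]   _   = suc k ℕ.* suc k , _ , sym (ℤ.pos-* (suc k) (suc k))
square-as-ℕ -[1+ k ]   _   = suc k ℕ.* suc k , _ , refl

descent-square : ∀ {f g} → (∀ {p} → Prime p → IndependentMod p f g) → ∀ {d} → d ≢ 0ℤ →
  ∀ {K} → Sym²Span₂ f g ((d * d) ·F K) → Sym²Span₂ f g K
descent-square {f} {g} ind {d} d≢0 {K} (l , m , n , d²K≡) = factorised (square-as-ℕ d d≢0)
  where
    factorised : (∃[ n₀ ] ℕ.NonZero n₀ × d * d ≡ + n₀) → Sym²Span₂ f g K
    factorised (n₀ , n₀≢0 , d*d≡n₀) = descent ind (PrimeFactorisation.factors fac) (PrimeFactorisation.factorsPrime fac)
        {K} {l} {m} {n} (trans (cong (_·F K) (sym (trans d*d≡n₀ (cong +_ (PrimeFactorisation.isFactorisation fac))))) d²K≡)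
      where
        fac = factorise n₀ {{n₀≢0}}

·F-0F : ∀ k → k ·F 0F ≡ 0F
·F-0F k =
  congₙ 5 quart
    (coefficientwise k)
    (coefficientwise k)
    (coefficientwise k)
    (coefficientwise k)
    (coefficientwise k)
  where
    coefficientwise : ∀ k →
      k * + 0
        ≡ + 0
    coefficientwise = solve-∀

1∣ : ∀ x → + 1 ∣ x
1∣ x = divides x (sym (ℤ.*-identityʳ x))

p^k∣⇒p^[1+k]∣ : ∀ p k {x} → + (p ℕ.^ k) ∣ x → + (p ℕ.^ suc k) ∣ x * + p
p^k∣⇒p^[1+k]∣ p k {x} (divides q x≡) = divides q (begin
  x * + p                    ≡⟨ cong (_* + p) x≡ ⟩
  q * + (p ℕ.^ k) * + p      ≡⟨ ℤ.*-assoc q (+ (p ℕ.^ k)) (+ p) ⟩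
  q * (+ (p ℕ.^ k) * + p)    ≡⟨ cong (q *_) (sym (ℤ.pos-* (p ℕ.^ k) p)) ⟩
  q * + (p ℕ.^ k ℕ.* p)      ≡⟨ cong (λ n → q * + n) (ℕ.*-comm (p ℕ.^ k) p) ⟩
  q * + (p ℕ.^ suc k)        ∎)

comb₂≡0⇒p^k∣ : ∀ {p} → Prime p → ∀ {f g} → IndependentMod p f g → ∀ {l m n} → comb₂ f g l m n ≡ 0F →
  ∀ k → + (p ℕ.^ k) ∣ l × + (p ℕ.^ k) ∣ m × + (p ℕ.^ k) ∣ n
comb₂≡0⇒p^k∣ p-prime ind {l} {m} {n} c≡0 zero = 1∣ l , 1∣ m , 1∣ n
comb₂≡0⇒p^k∣ {p} p-prime {f} {g} ind {l} {m} {n} c≡0 (suc k) =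
  step (comb₂-divide p-prime ind {0F} {l} {m} {n} (trans (·F-0F (+ p)) (sym c≡0)))
  where
    step : (∃[ l' ] ∃[ m' ] ∃[ n' ] (l ≡ l' * + p × m ≡ m' * + p × n ≡ n' * + p) × 0F ≡ comb₂ f g l' m' n') →
           + (p ℕ.^ suc k) ∣ l × + (p ℕ.^ suc k) ∣ m × + (p ℕ.^ suc k) ∣ n
    step (l' , m' , n' , (l≡ , m≡ , n≡) , 0≡comb₂') = lift (comb₂≡0⇒p^k∣ p-prime ind (sym 0≡comb₂') k)
      where
        lift : + (p ℕ.^ k) ∣ l' × + (p ℕ.^ k) ∣ m' × + (p ℕ.^ k) ∣ n' →
               + (p ℕ.^ suc k) ∣ l × + (p ℕ.^ suc k) ∣ m × + (p ℕ.^ suc k) ∣ n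
        lift (d₁ , d₂ , d₃) = subst (+ (p ℕ.^ suc k) ∣_) (sym l≡) (p^k∣⇒p^[1+k]∣ p k d₁)
                            , subst (+ (p ℕ.^ suc k) ∣_) (sym m≡) (p^k∣⇒p^[1+k]∣ p k d₂)
                            , subst (+ (p ℕ.^ suc k) ∣_) (sym n≡) (p^k∣⇒p^[1+k]∣ p k d₃)

n<2^n : ∀ n → n ℕ.< 2 ℕ.^ n
n<2^n zero    = ℕ.s≤s ℕ.z≤n
n<2^n (suc n) = subst₂ ℕ._≤_ (ℕ.+-comm (suc n) 1) (cong (2 ℕ.^ n ℕ.+_) (sym (ℕ.+-identityʳ (2 ℕ.^ n))))
                  (ℕ.+-mono-≤ (n<2^n n) (ℕ.m^n>0 2 n))

ℕ-2^k∣⇒≡0 : ∀ n → (∀ k → 2 ℕ.^ k ℕ.∣ n) → n ≡ 0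
ℕ-2^k∣⇒≡0 zero    _     = refl
ℕ-2^k∣⇒≡0 (suc n) 2^k∣n = ⊥-elim (ℕ.<⇒≱ (n<2^n (suc n)) (ℕ.∣⇒≤ (2^k∣n (suc n))))

2^k∣⇒≡0 : ∀ x → (∀ k → + (2 ℕ.^ k) ∣ x) → x ≡ 0ℤ
2^k∣⇒≡0 x 2^k∣x = ℤ.∣i∣≡0⇒i≡0 (ℕ-2^k∣⇒≡0 ℤ.∣ x ∣ (λ k → ∣⇒∣ᵤ (2^k∣x k)))

∙-·Q : ∀ ℓ k φ → ℓ ∙ (k ·Q φ) ≡ k * (ℓ ∙ φ)
∙-·Q (quad a₀ a₁ a₂) k (quad b₀ b₁ b₂) = expanded a₀ a₁ a₂ k b₀ b₁ b₂
  where
    expanded : ∀ a₀ a₁ a₂ k b₀ b₁ b₂ →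
      a₀ * (k * b₀) + a₁ * (k * b₁) + a₂ * (k * b₂)
        ≡ k * (a₀ * b₀ + a₁ * b₁ + a₂ * b₂)
    expanded = solve-∀

·Q-lin : ∀ k s t f g → k ·Q ((s ·Q f) +Q (t ·Q g)) ≡ ((s * k) ·Q f) +Q ((t * k) ·Q g)
·Q-lin k s t (quad a₀ a₁ a₂) (quad b₀ b₁ b₂) =
  congₙ 3 quad
    (coefficientwise k s t a₀ b₀)
    (coefficientwise k s t a₁ b₁)
    (coefficientwise k s t a₂ b₂)
  where
    coefficientwise : ∀ k s t a₀ b₀ →
      k * (s * a₀ + t * b₀)
        ≡ s * k * a₀ + t * k * b₀
    coefficientwise = solve-∀

lin-difference : ∀ f g s t s' t' →
  ((s - s') ·Q f) +Q ((t - t') ·Q g) ≡ ((s ·Q f) +Q (t ·Q g)) +Q (-Q ((s' ·Q f) +Q (t' ·Q g)))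
lin-difference (quad a₀ a₁ a₂) (quad b₀ b₁ b₂) s t s' t' =
  congₙ 3 quad
    (coefficientwise a₀ b₀ s t s' t')
    (coefficientwise a₁ b₁ s t s' t')
    (coefficientwise a₂ b₂ s t s' t')
  where
    coefficientwise : ∀ a₀ b₀ s t s' t' →
      (s - s') * a₀ + (t - t') * b₀
        ≡ s * a₀ + t * b₀ + - (s' * a₀ + t' * b₀)
    coefficientwise = solve-∀

+Q-inverseʳ : ∀ φ → φ +Q (-Q φ) ≡ 0Q
+Q-inverseʳ (quad a₀ a₁ a₂) =
  congₙ 3 quad (coefficientwise a₀) (coefficientwise a₁) (coefficientwise a₂)
  where
    coefficientwise : ∀ a₀ →
      a₀ + - a₀
        ≡ + 0
    coefficientwise = solve-∀

Independent⇒coefficients-unique : ∀ {f g} → Independent f g → ∀ {s t s' t'} →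
  (s ·Q f) +Q (t ·Q g) ≡ (s' ·Q f) +Q (t' ·Q g) → s ≡ s' × t ≡ t'
Independent⇒coefficients-unique {f} {g} ind {s} {t} {s'} {t'} eq =
  Product.map (ℤ.i-j≡0⇒i≡j s s') (ℤ.i-j≡0⇒i≡j t t') (ind (s - s') (t - t') (begin
    ((s - s') ·Q f) +Q ((t - t') ·Q g)                         ≡⟨ lin-difference f g s t s' t' ⟩
    ((s ·Q f) +Q (t ·Q g)) +Q (-Q ((s' ·Q f) +Q (t' ·Q g)))    ≡⟨ cong (_+Q (-Q ((s' ·Q f) +Q (t' ·Q g)))) eq ⟩
    ((s' ·Q f) +Q (t' ·Q g)) +Q (-Q ((s' ·Q f) +Q (t' ·Q g)))  ≡⟨ +Q-inverseʳ ((s' ·Q f) +Q (t' ·Q g)) ⟩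
    0Q                                                         ∎))

-- W_J is a saturated sublattice (a kernel), so a basis of it stays independent modulo every prime.
basis⇒IndependentMod : ∀ {J f g} → det (M J) ≢ 0ℤ → IsBasisW J f g → ∀ {p} → Prime p → IndependentMod p f g
basis⇒IndependentMod {J} {f} {g} d≢0 (f∈W , g∈W , W⊆span , ind) {p} p-prime s t
  (divides a' a≡ , divides b' b≡ , divides c' c≡) = coefficients (W⊆span h h∈W)
  where
    P = + p
    h = quad a' b' c'
    P·h≡ : P ·Q h ≡ (s ·Q f) +Q (t ·Q g)
    P·h≡ = congₙ 3 quad (trans (ℤ.*-comm P a') (sym a≡)) (trans (ℤ.*-comm P b') (sym b≡)) (trans (ℤ.*-comm P c') (sym c≡))
    h∈W : InW J h
    h∈W = ⟂ℓ⇒InW J h (*-distinct⇒zero {P} {0ℤ} (prime≢0 p-prime) (begin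
      P * (ℓ J ∙ h)                  ≡⟨ ∙-·Q (ℓ J) P h ⟨
      ℓ J ∙ (P ·Q h)                 ≡⟨ cong (ℓ J ∙_) P·h≡ ⟩
      ℓ J ∙ ((s ·Q f) +Q (t ·Q g))   ≡⟨ ℓ∙-lin≡0 J s t d≢0 f∈W g∈W ⟩
      0ℤ                             ∎))
    coefficients : Span₂ f g h → P ∣ s × P ∣ t
    coefficients (s' , t' , h≡) = Product.map (divides s') (divides t')
      (Independent⇒coefficients-unique ind (trans (sym P·h≡) (trans (cong (P ·Q_) h≡) (·Q-lin P s' t' f g))))

proposition3p7 : (J : Quad) → gcd3 J ≡ + 1 → disc J ≢ + 0 →
    (f g : Quad) → IsBasisW J f g → IsBasisV J (f *Q f) (f *Q g) (g *Q g)
proposition3p7 J _ disc≢0 f g basis@(f∈W , g∈W , W⊆span , ind) =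
  InV-*Q {J} {f} {f} f∈W f∈W , InV-*Q {J} {f} {g} f∈W g∈W , InV-*Q {J} {g} {g} g∈W g∈W , spanning , independence
  where
    d≢0 = det≢0 J disc≢0
    indMod : ∀ {p} → Prime p → IndependentMod p f g
    indMod = basis⇒IndependentMod {J} {f} {g} d≢0 basis
    spanning : ∀ K → InV J K → Sym²Span₂ f g K
    spanning K K∈V = descent-square indMod ([f,g,J]≢0 J d≢0 f∈W g∈W ind)
                       ([f,g,J]²K∈Sym²Span₂ {J} {f} {g} {K} d≢0 f∈W g∈W W⊆span K∈V)
    independence : ∀ l m n → comb₂ f g l m n ≡ 0F → l ≡ + 0 × m ≡ + 0 × n ≡ + 0
    independence l m n c≡0 =
      2^k∣⇒≡0 l (proj₁ ∘ 2^k∣) , 2^k∣⇒≡0 m (proj₁ ∘ proj₂ ∘ 2^k∣) , 2^k∣⇒≡0 n (proj₂ ∘ proj₂ ∘ 2^k∣)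
      where 2^k∣ = comb₂≡0⇒p^k∣ prime[2] (indMod prime[2]) {l} {m} {n} c≡0
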